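{- Let $G$ be a tree on $k$ vertices, $n\ge1$, $e=(s,t)$ an edge of $G$, and $i$ an integer with $1\le i<n$. Then among the $e$-cycles of length $2^i$ in $\Gamma^G_n$ there are $(n_G(t,s)-1)k^{n-1-i}$ cycles in each of which each of the two special edges $\{u,v\}$ satisfies \[ n(u,v)\,n(v,u) = n_G(s,t)\,k^{i-1}\left(k^n-n_G(s,t)k^{i-1}\right), \] and in each of the remaining $(n_G(s,t)-1)k^{n-1-i}$ $e$-cycles of length $2^i$ each of the two special edges $\{u,v\}$ satisfies \[ n(u,v)\,n(v,u) = n_G(t,s)\,k^{i-1}\left(k^n-n_G(t,s)k^{i-1}\right), \] where $n(u,v),n(v,u)$ are computed in $\Gamma^G_n$ and $n_G(\cdot,\cdot)$ in $G$.
   Context: Let $G$ be a finite tree with vertex set $V$, $|V|=k$, and fix an orientation of each edge. For an oriented edge $e=(s,t)$ of $G$ define a bijection $e$ of the set $V^n$ of words of length $n$ over $V$ recursively: $e$ fixes the empty word, and for a letter $z\in V$ and a word $w$, $e(sw)=t\,e(w)$, $e(tw)=sw$, and $e(zw)=zw$ for $z\notin\{s,t\}$. The $n$-th Schreier graph $\Gamma^G_n$ is the multigraph with vertex set $V^n$ having, for each word $u\in V^n$ and each edge $e$ of $G$, one edge labelled $e$ joining $u$ and $e(u)$ (orbits of size $2$ give two parallel edges). The edges labelled $e$ decompose into one cycle per orbit of $e$ on $V^n$; these are the $e$-cycles. Every $e$-cycle $C$ of length $2^i$ with $1\le i<n$ has vertex set $\{xw : x\in\{s,t\}^i\}$ for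 a word $w$ of length $n-i$ whose first letter is not in $\{s,t\}$. The special edges of $C$ are the edge labelled $e$ joining $s^iw$ and $t^iw$ and the edge labelled $e$ joining $s^{i-1}tw$ and $t^{i-1}sw$. For adjacent vertices $u,v$ of a graph, $n(u,v)$ denotes the number of vertices strictly closer (in graph distance) to $u$ than to $v$. -}

module Defs where

open import Data.Nat using (ℕ; zero; suc; _+_; _*_; _∸_; _^_; _≤_; _<_; _<ᵇ_)
open import Data.Nat.Properties using (m+[n∸m]≡n)
open import Data.Bool using (Bool; true; false; _∨_; if_then_else_; not)
open import Data.Fin using (Fin)
import Data.Fin as F
open import Data.Bool.ListAction using (any)
open import Data.List using (List; []; _∷_; length; filterᵇ; concatMap; map; _++_; allFin)
open import Data.Vec using (Vec; []; _∷_; replicate; cast)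
import Data.Vec as V
import Data.Vec.Properties as VP
open import Data.Product using (_×_; _,_; ∃)
open import Relation.Binary.PropositionalEquality using (_≡_)
open import Relation.Binary.Definitions using (DecidableEquality)
open import Relation.Nullary.Decidable using (⌊_⌋)

record FinGraph : Set₁ where
  field
    Vx    : Set
    _≟_   : DecidableEquality Vx
    verts : List Vx
    nbrs  : Vx → List Vx

module _ (Γ : FinGraph) where
  open FinGraph Γ

  reach : ℕ → Vx → Vx → Bool
  reach zero    u w = ⌊ u ≟ w ⌋
  reach (suc m) u w = reach m u w ∨ any (λ x → reach m u x) (nbrs w)

  -- least m < N with p m, or N if there is none
  least : ℕ → (ℕ → Bool) → ℕ
  least zero    p = zero
  least (suc N) p = if p zero then zero else suc (least N (λ m → p (suc m)))

  -- graph distance (for connected graphs; the search bound |V| suffices)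
  dist : Vx → Vx → ℕ
  dist u w = least (length verts) (λ m → reach m u w)

  nClose : Vx → Vx → ℕ
  nClose u v = length (filterᵇ (λ w → dist w u <ᵇ dist w v) verts)

  Connected : Set
  Connected = ∀ u w → ∃ λ m → reach m u w ≡ true

_==_ : ∀ {k} → Fin k → Fin k → Bool
a == b = ⌊ a F.≟ b ⌋

treeGraph : (k : ℕ) → List (Fin k × Fin k) → FinGraph
treeGraph k E = record
  { Vx = Fin k ; _≟_ = F._≟_ ; verts = allFin k
  ; nbrs = λ x → concatMap (λ { (s , t) →
       (if x == s then t ∷ [] else []) ++ (if x == t then s ∷ [] else []) }) E }

IsTree : (k : ℕ) → List (Fin k × Fin k) → Set
IsTree k E = Connected (treeGraph k E) × (length E + 1 ≡ k)

act : ∀ {k n} → Fin k × Fin k → Vec (Fin k) n → Vec (Fin k) n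
act e [] = []
act (s , t) (z ∷ w) =
  if z == s then t ∷ act (s , t) w
  else (if z == t then s ∷ w else z ∷ w)

actInv : ∀ {k n} → Fin k × Fin k → Vec (Fin k) n → Vec (Fin k) n
actInv e [] = []
actInv (s , t) (z ∷ w) =
  if z == t then s ∷ actInv (s , t) w
  else (if z == s then t ∷ w else z ∷ w)

allWords : (k n : ℕ) → List (Vec (Fin k) n)
allWords k zero    = [] ∷ []
allWords k (suc n) = concatMap (λ z → map (z ∷_) (allWords k n)) (allFin k)

schreier : (k : ℕ) → List (Fin k × Fin k) → (n : ℕ) → FinGraph
schreier k E n = record
  { Vx = Vec (Fin k) n ; _≟_ = VP.≡-dec F._≟_ ; verts = allWords k n
  ; nbrs = λ w → concatMap (λ e → act e w ∷ actInv e w ∷ []) E }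

-- e-cycles of length 2^i, indexed by the word w of length n - i whose
-- first letter is not in {s, t}

headOK : ∀ {k m} → Fin k → Fin k → Vec (Fin k) m → Bool
headOK s t []      = false
headOK s t (z ∷ _) = not (z == s ∨ z == t)

cycleWords : (k : ℕ) → Fin k → Fin k → (m : ℕ) → List (Vec (Fin k) m)
cycleWords k s t m = filterᵇ (headOK s t) (allWords k m)

count : ∀ {A : Set} → (A → Bool) → List A → ℕ
count p xs = length (filterᵇ p xs)

powLast : ∀ {A : Set} (i : ℕ) → A → A → Vec A i
powLast zero          a b = []
powLast (suc zero)    a b = b ∷ []
powLast (suc (suc i)) a b = a ∷ powLast (suc i) a b

glue : ∀ {k n i} → i ≤ n → Vec (Fin k) i → Vec (Fin k) (n ∸ i) → Vec (Fin k) n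
glue i≤n x w = cast (m+[n∸m]≡n i≤n) (x V.++ w)

special₁ : ∀ {k n i} → i ≤ n → Fin k → Fin k → Vec (Fin k) (n ∸ i) →
           Vec (Fin k) n × Vec (Fin k) n
special₁ {i = i} p s t w = glue p (replicate i s) w , glue p (replicate i t) w

special₂ : ∀ {k n i} → i ≤ n → Fin k → Fin k → Vec (Fin k) (n ∸ i) →
           Vec (Fin k) n × Vec (Fin k) n
special₂ {i = i} p s t w = glue p (powLast i s t) w , glue p (powLast i t s) w

edgeProd : (Γ : FinGraph) → FinGraph.Vx Γ × FinGraph.Vx Γ → ℕ
edgeProd Γ (u , v) = nClose Γ u v * nClose Γ v u

-- Removing e splits the tree G into the side of s and the side of t, and a
-- vertex of G is closer to s than to t exactly when it lies on the side of s.
-- In Γ^G_n every word hangs from a vertex of the e-cycle C = {x w : x ∈ {s,t}^i}: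
-- the words x w hang from the cycle vertex read off x, every other word hangs
-- from s^i w or t^i w according to the side of the first letter of w, and a walk
-- leaving the words hanging from a cycle vertex passes through that vertex.  On
-- the prefixes x, act e is the binary odometer, so the two special edges of C are
-- antipodal and the last letter of x splits C into two halves; comparing
-- potentials along the cycle shows that each half is closer to one end of each
-- special edge.  Hence n(u,v) counts the words hanging from one half, which are
-- n_G(s,t) k^(i-1) or k^n - n_G(t,s) k^(i-1) many, depending on the side of the
-- first letter of w; counting the words w by that side counts the e-cycles.

module Submission where

open import Defs
open import Data.Nat using (_≤?_; ℕ; zero; suc; _+_; _*_; _∸_; _^_; _≤_; _<_; z≤n; s≤s; _<ᵇ_; pred)
open import Data.Bool using (Bool; true; false; _∨_; _∧_; not; if_then_else_; T; _xor_)
open import Data.Bool.Properties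
  using (not-involutive; T-≡; T-not-≡; ∨-zeroʳ; not-¬; ∧-identityʳ; ∧-zeroʳ; xor-same; if-float; not-distribˡ-xor)
open import Data.Bool.ListAction using (any; or)
open import Data.List using (List; []; _∷_; length; filterᵇ; _++_; allFin; lookup; concatMap; map; tabulate)
open import Data.List.Properties
  using (map-cong; filter-≐; filter-some; filter-notAll; filter-++; length-++; map-tabulate; length-tabulate)
open import Data.List.Membership.Propositional using (_∈_; lose; find)
open import Data.List.Relation.Unary.Any using (here; there; index)
open import Data.Product using (Σ; _×_; _,_; ∃; proj₁; proj₂)
open import Data.Sum using (_⊎_; inj₁; inj₂)
open import Function using (_∘_; id)
open import Relation.Nullary using (¬_; yes; no; contradiction; Dec)
open import Relation.Nullary.Decidable using (⌊_⌋; T?; toWitness; fromWitness; fromWitnessFalse)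
open import Function.Bundles using (Equivalence)
open import Data.List.Membership.Propositional.Properties
  using (∈-length; ∈-allFin; ∈-++⁻; ∈-++⁺ˡ; ∈-++⁺ʳ; ∈-∃++; ∈-map⁺; ∈-filter⁻)
open import Data.List.Relation.Unary.Any.Properties using (any⁺; any⁻; lookup-index; concatMap⁺; concatMap⁻)
open import Data.Fin using (Fin; punchIn)
open import Data.Fin.Properties using (injective⇒≤; punchIn-injective; punchInᵢ≢i)
open import Data.Vec using (Vec; []; _∷_; replicate)
open import Data.Nat.Properties
open import Relation.Binary.PropositionalEquality
import Data.Product as Product
import Data.Sum as Sum
import Data.Fin as F
import Data.Fin.Properties as FP
import Data.Vec.Properties as VP

module _ {A : Set} where

  count-cong : {p q : A → Bool} → (∀ x → p x ≡ q x) → ∀ xs → count p xs ≡ count q xs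
  count-cong p≗q xs =
    cong length (filter-≐ (T? ∘ _) (T? ∘ _) (subst T (p≗q _) , subst T (sym (p≗q _))) xs)

  count-pos : ∀ p {xs} {x : A} → x ∈ xs → p x ≡ true → 0 < count p xs
  count-pos p x∈xs px = filter-some (T? ∘ p) (lose x∈xs (subst T (sym px) _))

  count-< : ∀ p {xs} {x : A} → x ∈ xs → p x ≡ false → count p xs < length xs
  count-< p {xs} x∈xs px = filter-notAll (T? ∘ p) xs (lose x∈xs (subst T px))

  count-++ : ∀ p (xs ys : List A) → count p (xs ++ ys) ≡ count p xs + count p ys
  count-++ p xs ys = trans (cong length (filter-++ (T? ∘ p) xs ys)) (length-++ (filterᵇ p xs))

  count-+-count-not : ∀ p (xs : List A) → count p xs + count (not ∘ p) xs ≡ length xs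
  count-+-count-not p [] = refl
  count-+-count-not p (x ∷ xs) with p x
  ... | true  = cong suc (count-+-count-not p xs)
  ... | false = trans (+-suc _ _) (cong suc (count-+-count-not p xs))

  count-mono : ∀ {p q} → (∀ x → p x ≡ true → q x ≡ true) → ∀ (xs : List A) → count p xs ≤ count q xs
  count-mono p⇒q [] = z≤n
  count-mono {p} {q} p⇒q (x ∷ xs) with p x in px | q x in qx
  ... | true  | true  = s≤s (count-mono p⇒q xs)
  ... | true  | false = contradiction (trans (sym (p⇒q x px)) qx) λ ()
  ... | false | true  = m≤n⇒m≤1+n (count-mono p⇒q xs)
  ... | false | false = count-mono p⇒q xs

  count-<-count : ∀ {p q} → (∀ x → p x ≡ true → q x ≡ true) → ∀ {xs : List A} {y} → y ∈ xs →
                  p y ≡ false → q y ≡ true → count p xs < count q xs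
  count-<-count p⇒q {x ∷ xs} (here refl) px qx rewrite px | qx = s≤s (count-mono p⇒q xs)
  count-<-count {p} {q} p⇒q {x ∷ xs} (there y∈xs) py qy with p x in px | q x in qx
  ... | true  | true  = s≤s (count-<-count p⇒q y∈xs py qy)
  ... | true  | false = contradiction (trans (sym (p⇒q x px)) qx) λ ()
  ... | false | true  = m≤n⇒m≤1+n (count-<-count p⇒q y∈xs py qy)
  ... | false | false = count-<-count p⇒q y∈xs py qy

  count-map : ∀ (p : A → Bool) {B : Set} (f : B → A) xs → count p (map f xs) ≡ count (p ∘ f) xs
  count-map p f []       = refl
  count-map p f (x ∷ xs) with p (f x)
  ... | true  = cong suc (count-map p f xs)
  ... | false = count-map p f xs

  count-const : ∀ b (xs : List A) → count (λ _ → b) xs ≡ (if b then length xs else 0)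
  count-const true  []       = refl
  count-const false []       = refl
  count-const true  (x ∷ xs) = cong suc (count-const true xs)
  count-const false (x ∷ xs) = count-const false xs

  count-filterᵇ : ∀ (p q : A → Bool) xs → count p (filterᵇ q xs) ≡ count (λ x → q x ∧ p x) xs
  count-filterᵇ p q []       = refl
  count-filterᵇ p q (x ∷ xs) with q x
  ... | false = count-filterᵇ p q xs
  ... | true with p x
  ...   | true  = cong suc (count-filterᵇ p q xs)
  ...   | false = count-filterᵇ p q xs

  count-split : ∀ (p q : A → Bool) xs → count p xs ≡ count (λ x → q x ∧ p x) xs + count (λ x → not (q x) ∧ p x) xs
  count-split p q []       = refl
  count-split p q (x ∷ xs) with p x | q x
  ... | true  | true  = cong suc (count-split p q xs)
  ... | true  | false = trans (cong suc (count-split p q xs)) (sym (+-suc _ _))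
  ... | false | true  = count-split p q xs
  ... | false | false = count-split p q xs

module _ {P : Set} {p? : Dec P} where

  ⌊⌋-true : P → ⌊ p? ⌋ ≡ true
  ⌊⌋-true p = Equivalence.to T-≡ (fromWitness p)

  ⌊⌋-false : ¬ P → ⌊ p? ⌋ ≡ false
  ⌊⌋-false ¬p = Equivalence.to T-not-≡ (fromWitnessFalse ¬p)

  ⌊⌋-witness : ⌊ p? ⌋ ≡ true → P
  ⌊⌋-witness h = toWitness (Equivalence.from T-≡ h)

==-refl : ∀ {k} (a : Fin k) → (a == a) ≡ true
==-refl a = ⌊⌋-true refl

==-≢ : ∀ {k} {a b : Fin k} → a ≢ b → (a == b) ≡ false
==-≢ = ⌊⌋-false

count-allFin-≡ : ∀ {n} (a : Fin n) → count (_== a) (allFin n) ≡ 1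
count-allFin-≡ {suc n} a = begin
  count (_== a) (F.zero ∷ tabulate F.suc)                ≡⟨ cong (λ xs → count (_== a) (F.zero ∷ xs)) (map-tabulate id F.suc) ⟨
  count (_== a) (F.zero ∷ map F.suc (allFin n))          ≡⟨ go a ⟩
  1                                                      ∎
  where
  open ≡-Reasoning
  suc== : ∀ (z b : Fin n) → (F.suc z == F.suc b) ≡ (z == b)
  suc== z b with F.suc z F.≟ F.suc b | z F.≟ b
  ... | yes _  | yes _  = refl
  ... | no _   | no _   = refl
  ... | yes eq | no z≢b = contradiction (FP.suc-injective eq) z≢b
  ... | no ne  | yes eq = contradiction (cong F.suc eq) ne
  go : ∀ a → count (_== a) (F.zero ∷ map F.suc (allFin n)) ≡ 1
  go F.zero    rewrite ==-refl {suc n} F.zero =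
    cong suc (trans (count-map (_== F.zero) F.suc (allFin n))
             (trans (count-cong (λ z → ⌊⌋-false {p? = F.suc z F.≟ F.zero} λ ()) (allFin n))
                    (count-const false (allFin n))))
  go (F.suc b) rewrite ⌊⌋-false {p? = F.zero F.≟ F.suc b} (λ ()) =
    trans (count-map (_== F.suc b) F.suc (allFin n)) (trans (count-cong (λ z → suc== z b) (allFin n)) (count-allFin-≡ b))

not≡true : ∀ {b} → not b ≡ true → b ≡ false
not≡true {false} _ = refl

not≡false : ∀ {b} → not b ≡ false → b ≡ true
not≡false {true} _ = refl

any-true : ∀ {A : Set} (p : A → Bool) {x xs} → x ∈ xs → p x ≡ true → any p xs ≡ true
any-true p x∈xs px = Equivalence.to T-≡ (any⁺ p (lose x∈xs (Equivalence.from T-≡ px)))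

any-true⁻ : ∀ {A : Set} (p : A → Bool) xs → any p xs ≡ true → ∃ λ x → x ∈ xs × p x ≡ true
any-true⁻ p xs h = Product.map₂ (Product.map₂ (Equivalence.to T-≡)) (find (any⁻ p xs (Equivalence.from T-≡ h)))

<ᵇ-≡true : ∀ {m n} → m < n → (m <ᵇ n) ≡ true
<ᵇ-≡true m<n = Equivalence.to T-≡ (<⇒<ᵇ m<n)

<ᵇ-≡false : ∀ {m n} → n ≤ m → (m <ᵇ n) ≡ false
<ᵇ-≡false {m} {n} n≤m with m <ᵇ n in m<ᵇn
... | false = refl
... | true  = contradiction (<ᵇ⇒< m n (subst T (sym m<ᵇn) _)) (≤⇒≯ n≤m)

-- Walks and distances in a finite graph

least-witness : ∀ Γ N (p : ℕ → Bool) {j} → j < N → p j ≡ true →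
                least Γ N p ≤ j × p (least Γ N p) ≡ true
least-witness Γ (suc N) p {j} j<N pj with p zero in p0
... | true = z≤n , p0
least-witness Γ (suc N) p {zero}  j<N        pj | false = contradiction (trans (sym pj) p0) λ ()
least-witness Γ (suc N) p {suc j} (s≤s j<N) pj | false = Product.map₁ s≤s (least-witness Γ N (p ∘ suc) j<N pj)

<least⇒false : ∀ Γ N (p : ℕ → Bool) {j} → j < least Γ N p → p j ≡ false
<least⇒false Γ (suc N) p {j} j<least with p zero in p0
<least⇒false Γ (suc N) p {zero}  j<least     | false = p0
<least⇒false Γ (suc N) p {suc j} (s≤s j<least) | false = <least⇒false Γ N (p ∘ suc) j<least

module Walks (Γ : FinGraph) where
  open FinGraph Γ

  -- a record rather than the bare equation, so that m, u and w can be inferred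
  record Reach (m : ℕ) (u w : Vx) : Set where
    constructor reach⁺
    field reach≡true : reach Γ m u w ≡ true
  open Reach public

  reach-refl : ∀ u → Reach 0 u u
  reach-refl u = reach⁺ (⌊⌋-true refl)

  reach-zero⁻ : ∀ {u w} → Reach 0 u w → u ≡ w
  reach-zero⁻ (reach⁺ h) = ⌊⌋-witness h

  reach-suc : ∀ {m u w} → Reach m u w → Reach (suc m) u w
  reach-suc {m} {u} {w} (reach⁺ h) = reach⁺ (cong (_∨ any (reach Γ m u) (nbrs w)) h)

  reach-step : ∀ {m u x w} → x ∈ nbrs w → Reach m u x → Reach (suc m) u w
  reach-step {m} {u} {x} {w} x∈ (reach⁺ h) =
    reach⁺ (trans (cong (reach Γ m u w ∨_) (any-true (reach Γ m u) x∈ h)) (∨-zeroʳ _))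

  reach-suc⁻ : ∀ {m u w} → Reach (suc m) u w → Reach m u w ⊎ ∃ λ x → x ∈ nbrs w × Reach m u x
  reach-suc⁻ {m} {u} {w} (reach⁺ h) with reach Γ m u w in h′
  ... | true  = inj₁ (reach⁺ h′)
  ... | false = inj₂ (Product.map₂ (Product.map₂ reach⁺) (any-true⁻ (reach Γ m u) (nbrs w) h))

  reach-+ : ∀ d {m u w} → Reach m u w → Reach (d + m) u w
  reach-+ zero    r = r
  reach-+ (suc d) r = reach-suc (reach-+ d r)

  reach-mono : ∀ {m m′ u w} → m ≤ m′ → Reach m u w → Reach m′ u w
  reach-mono {m} {m′} {u} {w} m≤m′ r = subst (λ j → Reach j u w) (m∸n+n≡m m≤m′) (reach-+ (m′ ∸ m) r)

  reach-trans : ∀ {a} b {u x w} → Reach a u x → Reach b x w → Reach (a + b) u w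
  reach-trans {a} zero {u} r r′ rewrite +-identityʳ a | reach-zero⁻ r′ = r
  reach-trans {a} (suc b) {u} r r′ rewrite +-suc a b with reach-suc⁻ r′
  ... | inj₁ r″            = reach-suc (reach-trans b r r″)
  ... | inj₂ (y , y∈ , r″) = reach-step y∈ (reach-trans b r r″)

  module _ (nbrs-sym : ∀ {x z} → x ∈ nbrs z → z ∈ nbrs x) where

    reach-sym : ∀ {m u w} → Reach m u w → Reach m w u
    reach-sym {zero} r rewrite reach-zero⁻ r = reach-refl _
    reach-sym {suc m} {u} {w} r with reach-suc⁻ r
    ... | inj₁ r′            = reach-suc (reach-sym r′)
    ... | inj₂ (x , x∈ , r′) = reach-trans {1} m (reach-step (nbrs-sym x∈) (reach-refl w)) (reach-sym r′)

  Reachable : Vx → Vx → Set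
  Reachable u w = ∃ λ m → Reach m u w

  reachable-trans : ∀ {u x w} → Reachable u x → Reachable x w → Reachable u w
  reachable-trans (a , r) (b , r′) = a + b , reach-trans b r r′

  reachable⇒connected : (∀ u w → Reachable u w) → Connected Γ
  reachable⇒connected reachable u w = Product.map₂ reach≡true (reachable u w)

  StrictlyCloser : Vx → Vx → Vx → Set
  StrictlyCloser y u v = ∀ m → Reach m y v → ∃ λ j → j < m × Reach j y u

  dist<dist : ∀ {y u v m} → m < length verts → Reach m y v → StrictlyCloser y u v →
              dist Γ y u < dist Γ y v
  dist<dist {y} {u} {v} m<N (reach⁺ r) closer
    with least-witness Γ (length verts) (λ j → reach Γ j y v) m<N r
  ... | d≤m , rd with closer _ (reach⁺ rd)
  ... | j , j<d , reach⁺ rj =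
    ≤-<-trans (proj₁ (least-witness Γ (length verts) (λ j → reach Γ j y u) (<-trans j<d (≤-<-trans d≤m m<N)) rj)) j<d

  module Exhaustive (complete : ∀ x → x ∈ verts) where

    private
      N = length verts

      suc-∸1 : ∀ {x} → x ∈ verts → suc (N ∸ 1) ≡ N
      suc-∸1 x∈ with N | ∈-length x∈
      ... | suc n | _ = refl

      N∸1<N : ∀ {x} → x ∈ verts → N ∸ 1 < N
      N∸1<N x∈ = ≤-reflexive (suc-∸1 x∈)

    -- The vertices reached from u within j steps grow strictly until they stop
    -- growing for good, so they are all reached within |V| - 1 steps.
    module _ (u : Vx) where

      Stable : ℕ → Set
      Stable j = ∀ d w → reach Γ (d + j) u w ≡ reach Γ j u w

      stable-from-step : ∀ {j} → (∀ w → reach Γ (suc j) u w ≡ reach Γ j u w) → Stable j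
      stable-from-step step zero    w = refl
      stable-from-step step (suc d) w =
        trans (cong₂ _∨_ (stable-from-step step d w)
                         (cong or (map-cong (stable-from-step step d) (nbrs w))))
              (step w)

      stable-suc : ∀ {j} → Stable j → Stable (suc j)
      stable-suc {j} st d w =
        trans (cong (λ e → reach Γ e u w) (+-suc d j)) (trans (st (suc d) w) (sym (st 1 w)))

      grows-or-stable : ∀ j → suc j ≤ count (reach Γ j u) verts ⊎ Stable j
      grows-or-stable zero = inj₁ (count-pos (reach Γ 0 u) (complete u) (reach≡true (reach-refl u)))
      grows-or-stable (suc j) with grows-or-stable j
      ... | inj₂ st = inj₂ (stable-suc st)
      ... | inj₁ grown with count (reach Γ (suc j) u) verts ≤? count (reach Γ j u) verts
      ...   | no  grows = inj₁ (≤-trans (s≤s grown) (≰⇒> grows))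
      ...   | yes same  = inj₂ (stable-suc (stable-from-step unchanged))
        where
        unchanged : ∀ w → reach Γ (suc j) u w ≡ reach Γ j u w
        unchanged w with reach Γ j u w in before
        ... | true  = refl
        ... | false with any (reach Γ j u) (nbrs w) in new
        ...   | false = refl
        ...   | true  = contradiction same (<⇒≱ (count-<-count (λ x h → reach≡true (reach-suc {j} {u} {x} (reach⁺ h)))
                                                              (complete w) before (cong₂ _∨_ before new)))

    shorten : ∀ {m u w} → Reach m u w → Reach (N ∸ 1) u w
    shorten {m} {u} {w} r with grows-or-stable u (N ∸ 1)
    ... | inj₁ all-reached with reach Γ (N ∸ 1) u w in reached
    ...   | true  = reach⁺ reached
    ...   | false = contradiction (≤-trans (≤-reflexive (sym (suc-∸1 (complete u)))) all-reached)
                                  (<⇒≱ (count-< (reach Γ (N ∸ 1) u) (complete w) reached))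
    shorten {m} {u} {w} r | inj₂ st with m ≤? N ∸ 1
    ... | yes m≤ = reach-mono m≤ r
    ... | no  m≰ = reach⁺ (trans (sym (st (m ∸ (N ∸ 1)) w))
                                 (trans (cong (λ j → reach Γ j u w) (m∸n+n≡m (<⇒≤ (≰⇒> m≰)))) (reach≡true r)))

    reach-dist : ∀ {m u w} → Reach m u w → Reach (dist Γ u w) u w
    reach-dist {m} {u} {w} r =
      reach⁺ (proj₂ (least-witness Γ N (λ j → reach Γ j u w) (N∸1<N (complete u)) (reach≡true (shorten r))))

    dist-≤ : ∀ {m u w} → m < N → Reach m u w → dist Γ u w ≤ m
    dist-≤ {m} {u} {w} m<N (reach⁺ r) = proj₁ (least-witness Γ N (λ j → reach Γ j u w) m<N r)

    dist<length : ∀ {m u w} → Reach m u w → dist Γ u w < N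
    dist<length {u = u} r = ≤-<-trans (dist-≤ (N∸1<N (complete u)) (shorten r)) (N∸1<N (complete u))

    <dist⇒¬reach : ∀ {j u w} → j < dist Γ u w → ¬ Reach j u w
    <dist⇒¬reach {j} {u} {w} j<d (reach⁺ r) =
      contradiction (trans (sym r) (<least⇒false Γ N (λ j → reach Γ j u w) j<d)) λ ()

    module _ (connected : Connected Γ) where

      connected-within : ∀ u w → Reach (N ∸ 1) u w
      connected-within u w = shorten {proj₁ (connected u w)} (reach⁺ (proj₂ (connected u w)))

      closer⇒<ᵇ : ∀ {u v} (P : Vx → Bool) →
                  (∀ y → P y ≡ true → StrictlyCloser y u v) → (∀ y → P y ≡ false → StrictlyCloser y v u) →
                  ∀ y → (dist Γ y u <ᵇ dist Γ y v) ≡ P y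
      closer⇒<ᵇ {u} {v} P closer closer′ y with P y in Py
      ... | true  = <ᵇ-≡true (dist<dist (N∸1<N (complete y)) (connected-within y v) (closer y Py))
      ... | false = <ᵇ-≡false (<⇒≤ (dist<dist (N∸1<N (complete y)) (connected-within y u) (closer′ y Py)))

      nClose≡count : ∀ {u v} (P : Vx → Bool) →
                     (∀ y → P y ≡ true → StrictlyCloser y u v) → (∀ y → P y ≡ false → StrictlyCloser y v u) →
                     nClose Γ u v ≡ count P verts × nClose Γ v u ≡ count (not ∘ P) verts
      nClose≡count P closer closer′ =
        count-cong (closer⇒<ᵇ P closer closer′) verts ,
        count-cong (closer⇒<ᵇ (not ∘ P) (λ y → closer′ y ∘ not≡true) (λ y → closer y ∘ not≡false)) verts

  -- The classes of ρ are joined to each other only at their gates, and Φ changes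
  -- by at most one along such a junction.  A walk leaving the class of y thus
  -- passes its gate, and Φ bounds how much of the walk is left after that.
  module Gates {C : Set} (ρ : Vx → C) (gate : C → Vx) (Φ : C → ℕ)
               (edge : ∀ {x z} → x ∈ nbrs z → ρ x ≡ ρ z ⊎ (x ≡ gate (ρ x) × Φ (ρ z) ≤ suc (Φ (ρ x))))
               where

    through-gate : ∀ {m y z} → Reach m y z →
                   ρ z ≡ ρ y ⊎ ∃ λ j → Reach j y (gate (ρ y)) × j + Φ (ρ z) ≤ m + Φ (ρ y)
    through-gate {zero} r rewrite reach-zero⁻ r = inj₁ refl
    through-gate {suc m} {y} {z} r with reach-suc⁻ r
    ... | inj₁ r′ = Sum.map₂ (Product.map₂ (Product.map₂ m≤n⇒m≤1+n)) (through-gate r′)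
    ... | inj₂ (x , x∈ , r′) with through-gate r′ | edge x∈
    ...   | inj₁ ρx≡ρy | inj₁ ρx≡ρz = inj₁ (trans (sym ρx≡ρz) ρx≡ρy)
    ...   | inj₂ (j , g , Φ≤) | inj₁ ρx≡ρz =
      inj₂ (j , g , subst (λ c → j + Φ c ≤ suc m + Φ (ρ y)) ρx≡ρz (m≤n⇒m≤1+n Φ≤))
    ...   | inj₁ ρx≡ρy | inj₂ (x≡gate , lip) =
      inj₂ (m , subst (Reach m y ∘ gate) ρx≡ρy (subst (Reach m y) x≡gate r′) , (begin
        m + Φ (ρ z)          ≤⟨ +-monoʳ-≤ m lip ⟩
        m + suc (Φ (ρ x))    ≡⟨ +-suc m _ ⟩
        suc m + Φ (ρ x)      ≡⟨ cong (λ c → suc m + Φ c) ρx≡ρy ⟩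
        suc m + Φ (ρ y)      ∎))
      where open ≤-Reasoning
    ...   | inj₂ (j , g , Φ≤) | inj₂ (_ , lip) =
      inj₂ (j , g , (begin
        j + Φ (ρ z)          ≤⟨ +-monoʳ-≤ j lip ⟩
        j + suc (Φ (ρ x))    ≡⟨ +-suc j _ ⟩
        suc (j + Φ (ρ x))    ≤⟨ s≤s Φ≤ ⟩
        suc m + Φ (ρ y)      ∎))
      where open ≤-Reasoning

    closer-than-target : ∀ {par tgt} (R : C → Set) → ¬ R (ρ tgt) →
                         (∀ c → R c → ∃ λ l → Reach l (gate c) par × l + suc (Φ c) ≤ Φ (ρ tgt)) →
                         ∀ y → R (ρ y) → StrictlyCloser y par tgt
    closer-than-target {par} {tgt} R ¬Rtgt shortcut y Ry m r with through-gate r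
    ... | inj₁ ρtgt≡ρy = contradiction (subst R (sym ρtgt≡ρy) Ry) ¬Rtgt
    ... | inj₂ (j , g , Φ≤) with shortcut (ρ y) Ry
    ...   | l , g⇝par , l≤ = j + l , shorter , reach-trans l g g⇝par
      where
      open ≤-Reasoning
      shorter : j + l < m
      shorter = +-cancelʳ-≤ (Φ (ρ y)) (suc (j + l)) m (begin
        suc (j + l) + Φ (ρ y)   ≡⟨ cong suc (+-assoc j l _) ⟩
        suc (j + (l + Φ (ρ y))) ≡⟨ sym (+-suc j _) ⟩
        j + suc (l + Φ (ρ y))   ≡⟨ cong (j +_) (sym (+-suc l _)) ⟩
        j + (l + suc (Φ (ρ y))) ≤⟨ +-monoʳ-≤ j l≤ ⟩
        j + Φ (ρ tgt)           ≤⟨ Φ≤ ⟩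
        m + Φ (ρ y)             ∎)

module _ {k : ℕ} where

  Joins : Fin k × Fin k → Fin k → Fin k → Set
  Joins (a , b) z x = (z ≡ a × x ≡ b) ⊎ (z ≡ b × x ≡ a)

  joins-sym : ∀ {f z x} → Joins f z x → Joins f x z
  joins-sym (inj₁ (z≡a , x≡b)) = inj₂ (x≡b , z≡a)
  joins-sym (inj₂ (z≡b , x≡a)) = inj₁ (x≡a , z≡b)

  private
    endpointNbrs : Fin k → Fin k × Fin k → List (Fin k)
    endpointNbrs z (a , b) = (if z == a then b ∷ [] else []) ++ (if z == b then a ∷ [] else [])

    endpointNbrs⁻ : ∀ z x f → x ∈ endpointNbrs z f → Joins f z x
    endpointNbrs⁻ z x (a , b) x∈ with z F.≟ a | z F.≟ b
    endpointNbrs⁻ z x (a , b) (here refl)         | yes z≡a | _       = inj₁ (z≡a , refl)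
    endpointNbrs⁻ z x (a , b) (there (here refl)) | yes _   | yes z≡b = inj₂ (z≡b , refl)
    endpointNbrs⁻ z x (a , b) (here refl)         | no _    | yes z≡b = inj₂ (z≡b , refl)

    endpointNbrs⁺ : ∀ z x f → Joins f z x → x ∈ endpointNbrs z f
    endpointNbrs⁺ z x (a , b) (inj₁ (z≡a , x≡b)) with z F.≟ a
    ... | yes _   = here x≡b
    ... | no z≢a  = contradiction z≡a z≢a
    endpointNbrs⁺ z x (a , b) (inj₂ (z≡b , x≡a)) with z F.≟ a | z F.≟ b
    ... | yes _ | yes _  = there (here x≡a)
    ... | no _  | yes _  = here x≡a
    ... | _     | no z≢b = contradiction z≡b z≢b

  module _ (E : List (Fin k × Fin k)) where
    open FinGraph (treeGraph k E)

    tree-nbrs⁻ : ∀ {x z} → x ∈ nbrs z → ∃ λ f → f ∈ E × Joins f z x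
    tree-nbrs⁻ = go E
      where
      go : ∀ E′ {x z} → x ∈ FinGraph.nbrs (treeGraph k E′) z → ∃ λ f → f ∈ E′ × Joins f z x
      go (f ∷ E′) {x} {z} x∈ with ∈-++⁻ (endpointNbrs z f) x∈
      ... | inj₁ x∈f = f , here refl , endpointNbrs⁻ z x f x∈f
      ... | inj₂ x∈E′ = Product.map₂ (Product.map₁ there) (go E′ x∈E′)

    tree-nbrs⁺ : ∀ {f x z} → f ∈ E → Joins f z x → x ∈ nbrs z
    tree-nbrs⁺ = go E
      where
      go : ∀ E′ {f x z} → f ∈ E′ → Joins f z x → x ∈ FinGraph.nbrs (treeGraph k E′) z
      go (g ∷ E′) {f} {x} {z} (here refl) j = ∈-++⁺ˡ (endpointNbrs⁺ z x f j)
      go (g ∷ E′) {f} {x} {z} (there f∈) j = ∈-++⁺ʳ (endpointNbrs z g) (go E′ f∈ j)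

    tree-nbrs-sym : ∀ {x z} → x ∈ nbrs z → z ∈ nbrs x
    tree-nbrs-sym x∈ = let f , f∈ , j = tree-nbrs⁻ x∈ in tree-nbrs⁺ f∈ (joins-sym j)

module ParentEdges {k} (E : List (Fin k × Fin k)) (r : Fin k)
                 (reaches : ∀ z → ∃ λ m → reach (treeGraph k E) m r z ≡ true) where
  private
    G = treeGraph k E
  open Walks G
  open Exhaustive ∈-allFin

  depth : Fin k → ℕ
  depth = dist G r

  parent-edge : ∀ z → z ≢ r → ∃ λ f → f ∈ E × ∃ λ x → Joins f z x × depth x < depth z
  parent-edge z z≢r = from-walk refl (reach-dist {proj₁ (reaches z)} (reach⁺ (proj₂ (reaches z))))
    where
    from-walk : ∀ {d} → d ≡ depth z → Reach d r z → ∃ λ f → f ∈ E × ∃ λ x → Joins f z x × depth x < depth z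
    from-walk {zero}  _  r⇝z = contradiction (sym (reach-zero⁻ r⇝z)) z≢r
    from-walk {suc d} d≡ r⇝z with reach-suc⁻ r⇝z
    ... | inj₁ r⇝z′ = contradiction r⇝z′ (<dist⇒¬reach (≤-reflexive d≡))
    ... | inj₂ (x , x∈ , r⇝x) =
      let f , f∈ , joins = tree-nbrs⁻ E x∈
          d<N = <-trans (n<1+n d) (subst (_< length (allFin k)) (sym d≡) (dist<length r⇝z))
      in  f , f∈ , x , joins , subst (depth x <_) d≡ (s≤s (dist-≤ d<N r⇝x))

  farther-endpoint-unique : ∀ {f z₁ z₂ x₁ x₂} → Joins f z₁ x₁ → Joins f z₂ x₂ →
                            depth x₁ < depth z₁ → depth x₂ < depth z₂ → z₁ ≡ z₂
  farther-endpoint-unique (inj₁ (refl , _)) (inj₁ (refl , _)) _ _ = refl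
  farther-endpoint-unique (inj₂ (refl , _)) (inj₂ (refl , _)) _ _ = refl
  farther-endpoint-unique (inj₁ (refl , refl)) (inj₂ (refl , refl)) x<z x′<z′ = contradiction x′<z′ (<⇒≯ x<z)
  farther-endpoint-unique (inj₂ (refl , refl)) (inj₁ (refl , refl)) x<z x′<z′ = contradiction x′<z′ (<⇒≯ x<z)

connected⇒k≤1+edges : ∀ {k} E (r : Fin k) → (∀ z → ∃ λ m → reach (treeGraph k E) m r z ≡ true) →
                      k ≤ suc (length E)
connected⇒k≤1+edges {suc k} E r reaches = s≤s (injective⇒≤ {f = edgeIndex} edgeIndex-injective)
  where
  open ParentEdges E r reaches

  parent : ∀ j → ∃ λ f → f ∈ E × ∃ λ x → Joins f (punchIn r j) x × depth x < depth (punchIn r j)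
  parent j = parent-edge (punchIn r j) (punchInᵢ≢i r j)

  edgeIndex : Fin k → Fin (length E)
  edgeIndex j = index (proj₁ (proj₂ (parent j)))

  edgeIndex-injective : ∀ {j₁ j₂} → edgeIndex j₁ ≡ edgeIndex j₂ → j₁ ≡ j₂
  edgeIndex-injective {j₁} {j₂} same with parent j₁ | parent j₂
  ... | f₁ , f₁∈ , _ , joins₁ , lt₁ | f₂ , f₂∈ , _ , joins₂ , lt₂ =
    punchIn-injective r j₁ j₂ (farther-endpoint-unique (subst (λ f → Joins f _ _) f₁≡f₂ joins₁) joins₂ lt₁ lt₂)
    where
    f₁≡f₂ : f₁ ≡ f₂
    f₁≡f₂ = trans (lookup-index f₁∈) (trans (cong (lookup E) same) (sym (lookup-index f₂∈)))

-- Cutting a tree at an edge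

record Cut {k} (E : List (Fin k × Fin k)) (s t : Fin k) : Set where
  field
    side        : Fin k → Bool
    side-s      : side s ≡ true
    side-t      : side t ≡ false
    only-e-cuts : ∀ {f} → f ∈ E → f ≡ (s , t) ⊎ side (proj₁ f) ≡ side (proj₂ f)

  gate : Bool → Fin k
  gate σ = if σ then s else t

  side-gate : ∀ σ → side (gate σ) ≡ σ
  side-gate true  = side-s
  side-gate false = side-t

  side-joins : ∀ {f z x} → f ∈ E → Joins f z x → side x ≡ side z ⊎ x ≡ gate (side x)
  side-joins {f} f∈ joins with only-e-cuts f∈
  side-joins f∈ (inj₁ (refl , refl)) | inj₂ same = inj₁ (sym same)
  side-joins f∈ (inj₂ (refl , refl)) | inj₂ same = inj₁ same
  side-joins f∈ (inj₁ (refl , refl)) | inj₁ refl = inj₂ (cong gate (sym side-t))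
  side-joins f∈ (inj₂ (refl , refl)) | inj₁ refl = inj₂ (cong gate (sym side-s))

module TreeCut {k} (E : List (Fin k × Fin k)) (tree : IsTree k E) {s t} (e∈ : (s , t) ∈ E) where
  private
    E₁ E₂ : List (Fin k × Fin k)
    E₁ = proj₁ (∈-∃++ e∈)
    E₂ = proj₁ (proj₂ (∈-∃++ e∈))

    E≡ : E ≡ E₁ ++ (s , t) ∷ E₂
    E≡ = proj₂ (proj₂ (∈-∃++ e∈))

    E∖e = E₁ ++ E₂
    G∖e = treeGraph k E∖e
    module G = Walks (treeGraph k E)
    open Walks G∖e
    open Exhaustive ∈-allFin
    N = length (allFin k)

    ∈E⁻ : ∀ {f} → f ∈ E → f ≡ (s , t) ⊎ f ∈ E∖e
    ∈E⁻ {f} f∈ with ∈-++⁻ E₁ (subst (f ∈_) E≡ f∈)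
    ... | inj₁ f∈E₁          = inj₂ (∈-++⁺ˡ f∈E₁)
    ... | inj₂ (here f≡e)    = inj₁ f≡e
    ... | inj₂ (there f∈E₂)  = inj₂ (∈-++⁺ʳ E₁ f∈E₂)

    length-E∖e : suc (length E∖e) ≡ length E
    length-E∖e = begin
      suc (length (E₁ ++ E₂))        ≡⟨ cong suc (length-++ E₁) ⟩
      suc (length E₁ + length E₂)    ≡⟨ sym (+-suc (length E₁) (length E₂)) ⟩
      length E₁ + suc (length E₂)    ≡⟨ sym (length-++ E₁) ⟩
      length (E₁ ++ (s , t) ∷ E₂)    ≡⟨ cong length (sym E≡) ⟩
      length E                       ∎
      where open ≡-Reasoning

    -- If s still reached t without e, every walk of the tree could avoid e,
    -- leaving a connected graph with k - 2 edges.
    s⇝t-needs-e : ∀ {m} → ¬ Reach m s t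
    s⇝t-needs-e s⇝t = <-irrefl refl (begin-strict
      k                      ≤⟨ connected⇒k≤1+edges E∖e s (Product.map₂ reach≡true ∘ reroute ∘ proj₂ ∘ from-tree) ⟩
      suc (length E∖e)       ≡⟨ length-E∖e ⟩
      length E               <⟨ n<1+n (length E) ⟩
      suc (length E)         ≡⟨ +-comm 1 (length E) ⟩
      length E + 1           ≡⟨ proj₂ tree ⟩
      k                      ∎)
      where
      open ≤-Reasoning
      from-tree : ∀ z → ∃ λ m → G.Reach m s z
      from-tree z = Product.map₂ G.reach⁺ (proj₁ tree s z)
      reroute : ∀ {m u w} → G.Reach m u w → ∃ λ m′ → Reach m′ u w
      reroute {zero} r rewrite G.reach-zero⁻ r = 0 , reach-refl _
      reroute {suc m} {u} {w} r with G.reach-suc⁻ r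
      ... | inj₁ r′ = reroute r′
      ... | inj₂ (x , x∈ , r′) with reroute r′ | tree-nbrs⁻ E {x} {w} x∈
      ...   | m′ , u⇝x | f , f∈ , joins with ∈E⁻ f∈ | joins
      ...     | inj₂ f∈E∖e | _                    = suc m′ , reach-step (tree-nbrs⁺ E∖e f∈E∖e joins) u⇝x
      ...     | inj₁ refl  | inj₁ (refl , refl)  = _ , reach-trans _ u⇝x (reach-sym (tree-nbrs-sym E∖e) s⇝t)
      ...     | inj₁ refl  | inj₂ (refl , refl)  = _ , reach-trans _ u⇝x s⇝t

    side : Fin k → Bool
    side = reach G∖e (N ∸ 1) s

    side-step : ∀ {a b} → b ∈ FinGraph.nbrs G∖e a → side a ≡ true → side b ≡ true
    side-step {a} {b} b∈ sa =
      reach≡true (shorten {suc (N ∸ 1)} (reach-step (tree-nbrs-sym E∖e {b} {a} b∈) (reach⁺ {N ∸ 1} sa)))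

    side-closed : ∀ {a b} → b ∈ FinGraph.nbrs G∖e a → side a ≡ side b
    side-closed {a} {b} b∈ with side a in sa | side b in sb
    ... | true  | true  = refl
    ... | false | false = refl
    ... | true  | false = contradiction (trans (sym (side-step b∈ sa)) sb) λ ()
    ... | false | true  = contradiction (trans (sym (side-step (tree-nbrs-sym E∖e b∈) sb)) sa) λ ()

    side-t : side t ≡ false
    side-t with side t in st
    ... | true  = contradiction (reach⁺ {N ∸ 1} st) s⇝t-needs-e
    ... | false = refl

  cut : Cut E s t
  cut = record
    { side        = side
    ; side-s      = reach≡true (reach-mono {0} {N ∸ 1} z≤n (reach-refl s))
    ; side-t      = side-t
    ; only-e-cuts = λ {f} f∈ →
        Sum.map₂ (λ f∈E∖e → side-closed (tree-nbrs⁺ E∖e {f} f∈E∖e (inj₁ (refl , refl)))) (∈E⁻ f∈)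
    }

module CutDistances {k} {E : List (Fin k × Fin k)} {s t} (cut : Cut E s t)
                    (connected : Connected (treeGraph k E)) where
  open Cut cut
  open Walks (treeGraph k E)
  open Exhaustive ∈-allFin

  private
    Φ : Bool → Bool → ℕ
    Φ σ b = if σ xor b then 1 else 0

    Φ≤1 : ∀ σ b → Φ σ b ≤ 1
    Φ≤1 σ b with σ xor b
    ... | true  = ≤-refl
    ... | false = z≤n

    Φ-gates : ∀ σ → suc (Φ σ σ) ≤ Φ σ (not σ)
    Φ-gates true  = ≤-refl
    Φ-gates false = ≤-refl

    edge : ∀ σ {x z} → x ∈ FinGraph.nbrs (treeGraph k E) z →
           side x ≡ side z ⊎ (x ≡ gate (side x) × Φ σ (side z) ≤ suc (Φ σ (side x)))
    edge σ {x} {z} x∈ with tree-nbrs⁻ E {x} {z} x∈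
    ... | f , f∈ , joins = Sum.map₂ (_, ≤-trans (Φ≤1 σ (side z)) (s≤s z≤n)) (side-joins f∈ joins)

  closer-to-own-gate : ∀ σ y → side y ≡ σ → StrictlyCloser y (gate σ) (gate (not σ))
  closer-to-own-gate σ = closer-than-target (_≡ σ) (λ eq → not-¬ refl (trans (sym eq) (side-gate (not σ))))
                                           shortcut
    where
    open Gates side gate (Φ σ) (edge σ)
    shortcut : ∀ c → c ≡ σ → ∃ λ l → Reach l (gate c) (gate σ) × l + suc (Φ σ c) ≤ Φ σ (side (gate (not σ)))
    shortcut c refl rewrite side-gate (not c) = 0 , reach-refl _ , Φ-gates c

  nClose-cut : nClose (treeGraph k E) s t ≡ count side (allFin k) ×
               nClose (treeGraph k E) t s ≡ count (not ∘ side) (allFin k)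
  nClose-cut = nClose≡count connected side (closer-to-own-gate true) (closer-to-own-gate false)

module _ {k : ℕ} where

  data Letter (a b z : Fin k) : Set where
    first  : z ≡ a → Letter a b z
    second : z ≢ a → z ≡ b → Letter a b z
    other  : z ≢ a → z ≢ b → Letter a b z

  letter : ∀ a b z → Letter a b z
  letter a b z with z F.≟ a | z F.≟ b
  ... | yes z≡a | _       = first z≡a
  ... | no z≢a  | yes z≡b = second z≢a z≡b
  ... | no z≢a  | no z≢b  = other z≢a z≢b

  module _ {m} (a b : Fin k) (r : Vec (Fin k) m) where

    act-first : act (a , b) (a ∷ r) ≡ b ∷ act (a , b) r
    act-first rewrite ==-refl a = refl

    act-second : b ≢ a → act (a , b) (b ∷ r) ≡ a ∷ r
    act-second b≢a rewrite ==-≢ b≢a | ==-refl b = refl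

    act-other : ∀ {z} → z ≢ a → z ≢ b → act (a , b) (z ∷ r) ≡ z ∷ r
    act-other z≢a z≢b rewrite ==-≢ z≢a | ==-≢ z≢b = refl

    actInv-second : actInv (a , b) (b ∷ r) ≡ a ∷ actInv (a , b) r
    actInv-second rewrite ==-refl b = refl

    actInv-first : a ≢ b → actInv (a , b) (a ∷ r) ≡ b ∷ r
    actInv-first a≢b rewrite ==-≢ a≢b | ==-refl a = refl

  actInv-act : ∀ {m} f (y : Vec (Fin k) m) → actInv f (act f y) ≡ y
  actInv-act f [] = refl
  actInv-act (a , b) (z ∷ y) with letter a b z
  ... | first refl        rewrite act-first z b y | actInv-second z b (act (z , b) y) = cong (z ∷_) (actInv-act (z , b) y)
  ... | second z≢a refl   rewrite act-second a z y z≢a = actInv-first a z y (z≢a ∘ sym)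
  ... | other z≢a z≢b     rewrite act-other a b y z≢a z≢b | ==-≢ z≢b | ==-≢ z≢a = refl

  act-actInv : ∀ {m} f (y : Vec (Fin k) m) → act f (actInv f y) ≡ y
  act-actInv f [] = refl
  act-actInv (a , b) (z ∷ y) with letter b a z
  ... | first refl        rewrite actInv-second a z y | act-first a z (actInv (a , z) y) = cong (z ∷_) (act-actInv (a , z) y)
  ... | second z≢b refl   rewrite actInv-first z b y z≢b = act-second z b y (z≢b ∘ sym)
  ... | other z≢b z≢a     rewrite ==-≢ z≢b | ==-≢ z≢a = act-other a b y z≢a z≢b

  act-replicate : ∀ (a b : Fin k) m → act (a , b) (replicate m a) ≡ replicate m b
  act-replicate a b zero    = refl
  act-replicate a b (suc m) rewrite act-first a b (replicate m a) = cong (b ∷_) (act-replicate a b m)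

module Schreier {k} (E : List (Fin k × Fin k)) (n : ℕ) where
  Γ = schreier k E n
  open FinGraph Γ using (nbrs)
  open Walks Γ public

  private
    moves : Vec (Fin k) n → Fin k × Fin k → List (Vec (Fin k) n)
    moves z f = act f z ∷ actInv f z ∷ []

  nbrs⁻ : ∀ {x z} → x ∈ nbrs z → ∃ λ f → f ∈ E × (x ≡ act f z ⊎ x ≡ actInv f z)
  nbrs⁻ {x} {z} x∈ with find (concatMap⁻ (moves z) {xs = E} x∈)
  ... | f , f∈ , here x≡         = f , f∈ , inj₁ x≡
  ... | f , f∈ , there (here x≡) = f , f∈ , inj₂ x≡

  ∈-nbrs-act : ∀ {f} → f ∈ E → ∀ y → y ∈ nbrs (act f y)
  ∈-nbrs-act {f} f∈ y = concatMap⁺ (moves (act f y)) {xs = E} (lose f∈ (there (here (sym (actInv-act f y)))))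

  ∈-nbrs-actInv : ∀ {f} → f ∈ E → ∀ y → y ∈ nbrs (actInv f y)
  ∈-nbrs-actInv {f} f∈ y = concatMap⁺ (moves (actInv f y)) {xs = E} (lose f∈ (here (sym (act-actInv f y))))

  nbrs-sym : ∀ {x z} → x ∈ nbrs z → z ∈ nbrs x
  nbrs-sym {x} {z} x∈ with nbrs⁻ {x} {z} x∈
  ... | f , f∈ , inj₁ refl = ∈-nbrs-act f∈ z
  ... | f , f∈ , inj₂ refl = ∈-nbrs-actInv f∈ z

  step-act : ∀ {f} → f ∈ E → ∀ y → Reach 1 y (act f y)
  step-act f∈ y = reach-step (∈-nbrs-act f∈ y) (reach-refl y)

  step-actInv : ∀ {f} → f ∈ E → ∀ y → Reach 1 y (actInv f y)
  step-actInv f∈ y = reach-step (∈-nbrs-actInv f∈ y) (reach-refl y)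

module SchreierConnected {k} (E : List (Fin k × Fin k)) (connected : Connected (treeGraph k E)) where
  private
    module S (n : ℕ) = Schreier E n
    module G = Walks (treeGraph k E)

  first-letter-step : ∀ {n f b c} (x : Vec (Fin k) n) → f ∈ E → Joins f b c → S.Reachable (suc n) (c ∷ x) (b ∷ x)
  first-letter-step {n} {a , b} x f∈ (inj₁ (refl , refl)) with b F.≟ a
  ... | yes refl = 0 , S.reach-refl (suc n) _
  ... | no b≢a   = 1 , subst (S.Reach (suc n) 1 (b ∷ x)) (act-second a b x b≢a) (S.step-act (suc n) f∈ (b ∷ x))
  first-letter-step {n} {a , b} x f∈ (inj₂ (refl , refl)) with a F.≟ b
  ... | yes refl = 0 , S.reach-refl (suc n) _
  ... | no a≢b   = 1 , subst (S.Reach (suc n) 1 (a ∷ x)) (actInv-first a b x a≢b) (S.step-actInv (suc n) f∈ (a ∷ x))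

  first-letter : ∀ {n m a b} (x : Vec (Fin k) n) → G.Reach m a b → S.Reachable (suc n) (a ∷ x) (b ∷ x)
  first-letter {n} {zero} x r rewrite G.reach-zero⁻ r = 0 , S.reach-refl (suc n) _
  first-letter {n} {suc m} {a} {b} x r with G.reach-suc⁻ r
  ... | inj₁ r′ = first-letter x r′
  ... | inj₂ (c , c∈ , r′) =
    let f , f∈ , joins = tree-nbrs⁻ E {c} {b} c∈
    in  S.reachable-trans (suc n) (first-letter x r′) (first-letter-step x f∈ joins)

  any-first-letter : ∀ {n} a b (x : Vec (Fin k) n) → S.Reachable (suc n) (a ∷ x) (b ∷ x)
  any-first-letter a b x = first-letter x (G.reach⁺ {proj₁ (connected a b)} (proj₂ (connected a b)))

  -- Before each step of the tail, move the first letter to the end of the edge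
  -- from which that edge acts on the tail.
  lift : ∀ {n m} {x₁ x₂ : Vec (Fin k) n} → S.Reach n m x₁ x₂ →
         ∀ c → ∃ λ c′ → S.Reachable (suc n) (c ∷ x₁) (c′ ∷ x₂)
  lift {n} {zero} r c rewrite S.reach-zero⁻ n r = c , 0 , S.reach-refl (suc n) _
  lift {n} {suc m} {x₁} {x₂} r c with S.reach-suc⁻ n r
  ... | inj₁ r′ = lift r′ c
  ... | inj₂ (z , z∈ , r′) with lift r′ c | S.nbrs⁻ n {z} {x₂} z∈
  ...   | c″ , c⇝c″ | (a , b) , f∈ , inj₁ z≡ = a , S.reachable-trans (suc n) c⇝c″
          (S.reachable-trans (suc n) (any-first-letter c″ b z)
            (1 , subst (S.Reach (suc n) 1 (b ∷ z)) (begin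
                 actInv (a , b) (b ∷ z)              ≡⟨ actInv-second a b z ⟩
                 a ∷ actInv (a , b) z                ≡⟨ cong (λ y → a ∷ actInv (a , b) y) z≡ ⟩
                 a ∷ actInv (a , b) (act (a , b) x₂) ≡⟨ cong (a ∷_) (actInv-act (a , b) x₂) ⟩
                 a ∷ x₂                              ∎) (S.step-actInv (suc n) f∈ (b ∷ z))))
    where open ≡-Reasoning
  ...   | c″ , c⇝c″ | (a , b) , f∈ , inj₂ z≡ = b , S.reachable-trans (suc n) c⇝c″
          (S.reachable-trans (suc n) (any-first-letter c″ a z)
            (1 , subst (S.Reach (suc n) 1 (a ∷ z)) (begin
                 act (a , b) (a ∷ z)                 ≡⟨ act-first a b z ⟩
                 b ∷ act (a , b) z                   ≡⟨ cong (λ y → b ∷ act (a , b) y) z≡ ⟩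
                 b ∷ act (a , b) (actInv (a , b) x₂) ≡⟨ cong (b ∷_) (act-actInv (a , b) x₂) ⟩
                 b ∷ x₂                              ∎) (S.step-act (suc n) f∈ (a ∷ z))))
    where open ≡-Reasoning

  schreier-reachable : ∀ n (y z : Vec (Fin k) n) → S.Reachable n y z
  schreier-reachable zero    []      []      = 0 , S.reach-refl 0 []
  schreier-reachable (suc n) (a ∷ x) (b ∷ x′) =
    let m , x⇝x′ = schreier-reachable n x x′
        c′ , ax⇝c′x′ = lift x⇝x′ a
    in  S.reachable-trans (suc n) ax⇝c′x′ (any-first-letter c′ b x′)

  schreier-connected : ∀ n → Connected (schreier k E n)
  schreier-connected n = S.reachable⇒connected n (schreier-reachable n)

module _ {A : Set} where

  takeN : ∀ {n} i → i ≤ n → Vec A n → Vec A i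
  takeN zero    _       _       = []
  takeN (suc i) (s≤s p) (a ∷ y) = a ∷ takeN i p y

  dropN : ∀ {n} i → Vec A n → Vec A (n ∸ i)
  dropN zero    y       = y
  dropN (suc i) []      = []
  dropN (suc i) (a ∷ y) = dropN i y

  headOr : ∀ {m} → A → Vec A m → A
  headOr d []      = d
  headOr d (a ∷ _) = a

  final : ∀ {m} → Vec A (suc m) → A
  final {zero}  (a ∷ []) = a
  final {suc m} (_ ∷ x)  = final x

module _ {k : ℕ} where

  glue-take-drop : ∀ {n} i (p : i ≤ n) (y : Vec (Fin k) n) → glue p (takeN i p y) (dropN i y) ≡ y
  glue-take-drop zero    p       y       = VP.cast-is-id refl y
  glue-take-drop (suc i) (s≤s p) (a ∷ y) = cong (a ∷_) (glue-take-drop i p y)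

  take-glue : ∀ {n} i (p : i ≤ n) (x : Vec (Fin k) i) w → takeN i p (glue p x w) ≡ x
  take-glue zero    p       []      w = refl
  take-glue (suc i) (s≤s p) (a ∷ x) w = cong (a ∷_) (take-glue i p x w)

  drop-glue : ∀ {n} i (p : i ≤ n) (x : Vec (Fin k) i) w → dropN i (glue p x w) ≡ w
  drop-glue zero    p       []      w = VP.cast-is-id refl w
  drop-glue (suc i) (s≤s p) (a ∷ x) w = drop-glue i p x w

  take-act : ∀ {n} i (p : i ≤ n) f (y : Vec (Fin k) n) → takeN i p (act f y) ≡ act f (takeN i p y)
  take-act zero    p       f       y       = refl
  take-act (suc i) (s≤s p) (a , b) (z ∷ y) with letter a b z
  ... | first refl     rewrite act-first z b y | act-first z b (takeN i p y) = cong (b ∷_) (take-act i p (z , b) y)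
  ... | second z≢a refl rewrite act-second a z y z≢a | act-second a z (takeN i p y) z≢a = refl
  ... | other z≢a z≢b  rewrite act-other a b y z≢a z≢b | act-other a b (takeN i p y) z≢a z≢b = refl

  drop-act : ∀ {n} i (p : i ≤ n) f (y : Vec (Fin k) n) →
             dropN i (act f y) ≡ dropN i y ⊎
             (takeN i p y ≡ replicate i (proj₁ f) × dropN i (act f y) ≡ act f (dropN i y))
  drop-act zero    p       f       y       = inj₂ (refl , refl)
  drop-act (suc i) (s≤s p) (a , b) (z ∷ y) with letter a b z
  ... | first refl rewrite act-first z b y =
    Sum.map₂ (λ (pre , suf) → cong (z ∷_) pre , suf) (drop-act i p (z , b) y)
  ... | second z≢a refl rewrite act-second a z y z≢a = inj₁ refl
  ... | other z≢a z≢b  rewrite act-other a b y z≢a z≢b = inj₁ refl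

  act-moves-head : ∀ {m} a b d (x : Vec (Fin k) m) → act (a , b) x ≢ x →
                   (headOr d x ≡ a ⊎ headOr d x ≡ b) × (headOr d (act (a , b) x) ≡ a ⊎ headOr d (act (a , b) x) ≡ b)
  act-moves-head a b d []      moved = contradiction refl moved
  act-moves-head a b d (z ∷ x) moved with letter a b z
  ... | first refl      rewrite act-first z b x = inj₁ refl , inj₂ refl
  ... | second z≢a refl rewrite act-second a z x z≢a = inj₂ refl , inj₁ refl
  ... | other z≢a z≢b   = contradiction (act-other a b x z≢a z≢b) moved

-- Projecting words onto {s, t}-words

module Projection {k} {E : List (Fin k × Fin k)} {s t : Fin k} (cut : Cut E s t) where
  open Cut cut

  s≢t : s ≢ t
  s≢t s≡t = contradiction (trans (sym side-s) (trans (cong side s≡t) side-t)) λ ()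

  onEdge : Fin k → Bool
  onEdge a = (a == s) ∨ (a == t)

  binary : ∀ {m} → Vec (Fin k) m → Bool
  binary []      = true
  binary (a ∷ r) = onEdge a ∧ binary r

  lastSide : ∀ {m} → Bool → Vec (Fin k) m → Bool
  lastSide σ []      = σ
  lastSide σ (a ∷ r) = lastSide (if onEdge a then σ else side a) r

  -- Each letter is replaced by the gate on the side of the last letter outside
  -- {s, t} after it (of the letter itself if there is none).  For a prefix x of
  -- a word x w, this is the vertex of the e-cycle of w from which x w hangs.
  project : ∀ {m} → Vec (Fin k) m → Vec (Fin k) m
  project []      = []
  project (a ∷ r) = gate (lastSide (side a) r) ∷ project r

  onEdge-s : onEdge s ≡ true
  onEdge-s rewrite ==-refl s = refl

  onEdge-t : onEdge t ≡ true
  onEdge-t rewrite ==-refl t | ==-≢ (s≢t ∘ sym) = refl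

  onEdge-gate : ∀ σ → onEdge (gate σ) ≡ true
  onEdge-gate true  = onEdge-s
  onEdge-gate false = onEdge-t

  onEdge⁻ : ∀ {a} → onEdge a ≡ true → a ≡ s ⊎ a ≡ t
  onEdge⁻ {a} h with letter s t a
  ... | first a≡s      = inj₁ a≡s
  ... | second _ a≡t   = inj₂ a≡t
  ... | other a≢s a≢t  rewrite ==-≢ a≢s | ==-≢ a≢t = contradiction h λ ()

  onEdge-other : ∀ {a} → a ≢ s → a ≢ t → onEdge a ≡ false
  onEdge-other a≢s a≢t rewrite ==-≢ a≢s | ==-≢ a≢t = refl

  onEdge∧side : ∀ z → onEdge z ∧ side z ≡ (z == s)
  onEdge∧side z with letter s t z
  ... | first refl      rewrite onEdge-s | side-s | ==-refl s = refl
  ... | second z≢s refl rewrite onEdge-t | side-t | ==-≢ z≢s = refl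
  ... | other z≢s z≢t   rewrite onEdge-other z≢s z≢t | ==-≢ z≢s = refl

  onEdge∧not-side : ∀ z → onEdge z ∧ not (side z) ≡ (z == t)
  onEdge∧not-side z with letter s t z
  ... | first refl      rewrite onEdge-s | side-s | ==-≢ s≢t = refl
  ... | second z≢s refl rewrite onEdge-t | side-t | ==-refl t = refl
  ... | other z≢s z≢t   rewrite onEdge-other z≢s z≢t | ==-≢ z≢t = refl

  count-off-edge : ∀ (g : Fin k → Bool) σ → (∀ z → onEdge z ∧ g z ≡ (z == gate σ)) →
                   count (λ z → not (onEdge z) ∧ g z) (allFin k) ≡ count g (allFin k) ∸ 1
  count-off-edge g σ on-edge = sym (begin
    count g (allFin k) ∸ 1                                   ≡⟨ cong (_∸ 1) (count-split g onEdge (allFin k)) ⟩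
    count (λ z → onEdge z ∧ g z) (allFin k) + rest ∸ 1       ≡⟨ cong (λ c → c + rest ∸ 1) on-edge-once ⟩
    1 + rest ∸ 1                                             ≡⟨ m+n∸m≡n 1 rest ⟩
    rest                                                     ∎)
    where
    open ≡-Reasoning
    rest = count (λ z → not (onEdge z) ∧ g z) (allFin k)
    on-edge-once = trans (count-cong on-edge (allFin k)) (count-allFin-≡ (gate σ))

  gate-side : ∀ {a} → onEdge a ≡ true → gate (side a) ≡ a
  gate-side {a} h with onEdge⁻ {a} h
  ... | inj₁ refl rewrite side-s = refl
  ... | inj₂ refl rewrite side-t = refl

  binary-head : ∀ {m} a (r : Vec (Fin k) m) → binary (a ∷ r) ≡ true → onEdge a ≡ true
  binary-head a r h with onEdge a
  ... | true = refl

  binary-head⁻ : ∀ {m} a (r : Vec (Fin k) m) → binary (a ∷ r) ≡ true → a ≡ s ⊎ a ≡ t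
  binary-head⁻ a r h = onEdge⁻ {a} (binary-head a r h)

  binary-tail : ∀ {m} a (r : Vec (Fin k) m) → binary (a ∷ r) ≡ true → binary r ≡ true
  binary-tail a r h with onEdge a
  ... | true = h

  binary-∷ : ∀ {m} a (r : Vec (Fin k) m) → onEdge a ≡ true → binary (a ∷ r) ≡ binary r
  binary-∷ a r h rewrite h = refl

  binary-replicate : ∀ {a} m → onEdge a ≡ true → binary (replicate m a) ≡ true
  binary-replicate zero    h = refl
  binary-replicate (suc m) h rewrite h = binary-replicate m h

  binary-powLast : ∀ {a b} m → onEdge a ≡ true → onEdge b ≡ true → binary (powLast m a b) ≡ true
  binary-powLast zero          ha hb = refl
  binary-powLast (suc zero)    ha hb rewrite hb = refl
  binary-powLast {a} {b} (suc (suc m)) ha hb =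
    trans (binary-∷ a (powLast (suc m) a b) ha) (binary-powLast (suc m) ha hb)

  binary-act : ∀ {m} (x : Vec (Fin k) m) → binary x ≡ true → binary (act (s , t) x) ≡ true
  binary-act []      _ = refl
  binary-act (a ∷ r) h with letter s t a
  ... | first refl      rewrite act-first s t r | onEdge-t = binary-act r (trans (sym (binary-∷ s r onEdge-s)) h)
  ... | second a≢s refl rewrite act-second s t r a≢s | onEdge-s = trans (sym (binary-∷ t r onEdge-t)) h
  ... | other a≢s a≢t   = contradiction (trans (sym (binary-head a r h)) (onEdge-other a≢s a≢t)) λ ()

  lastSide-skip : ∀ {m σ} a (r : Vec (Fin k) m) → side a ≡ σ → lastSide σ (a ∷ r) ≡ lastSide σ r
  lastSide-skip a r sa with onEdge a
  ... | true  = refl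
  ... | false = cong (λ τ → lastSide τ r) sa

  lastSide-binary : ∀ {m} σ (x : Vec (Fin k) m) → binary x ≡ true → lastSide σ x ≡ σ
  lastSide-binary σ []      _ = refl
  lastSide-binary σ (a ∷ r) h rewrite binary-head a r h = lastSide-binary σ r (binary-tail a r h)

  lastSide-nonbinary : ∀ {m} σ τ (x : Vec (Fin k) m) → binary x ≡ false → lastSide σ x ≡ lastSide τ x
  lastSide-nonbinary σ τ (a ∷ r) h with onEdge a
  ... | false = refl
  ... | true  = lastSide-nonbinary σ τ r h

  project-binary : ∀ {m} (x : Vec (Fin k) m) → binary x ≡ true → project x ≡ x
  project-binary []      _ = refl
  project-binary (a ∷ r) h = cong₂ _∷_
    (trans (cong gate (lastSide-binary (side a) r (binary-tail a r h))) (gate-side (binary-head a r h)))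
    (project-binary r (binary-tail a r h))

  binary-project : ∀ {m} (x : Vec (Fin k) m) → binary (project x) ≡ true
  binary-project []      = refl
  binary-project (a ∷ r) rewrite onEdge-gate (lastSide (side a) r) = binary-project r

  project-replicate : ∀ c m → project (replicate m c) ≡ replicate m (gate (side c))
  project-replicate c zero    = refl
  project-replicate c (suc m) = cong₂ _∷_ (cong gate (lastSide-replicate m)) (project-replicate c m)
    where
    lastSide-replicate : ∀ m → lastSide (side c) (replicate m c) ≡ side c
    lastSide-replicate zero    = refl
    lastSide-replicate (suc m) = trans (lastSide-skip c (replicate m c) refl) (lastSide-replicate m)

  module _ {a b σ} (side-a : side a ≡ σ) (side-b : side b ≡ σ) where

    lastSide-act-uncut : ∀ {m} (x : Vec (Fin k) m) → lastSide σ (act (a , b) x) ≡ lastSide σ x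
    lastSide-act-uncut []      = refl
    lastSide-act-uncut (z ∷ r) with letter a b z
    ... | first refl rewrite act-first z b r =
      trans (lastSide-skip b (act (z , b) r) side-b)
            (trans (lastSide-act-uncut r) (sym (lastSide-skip z r side-a)))
    ... | second z≢a refl rewrite act-second a z r z≢a =
      trans (lastSide-skip a r side-a) (sym (lastSide-skip z r side-b))
    ... | other z≢a z≢b rewrite act-other a b r z≢a z≢b = refl

    project-act-uncut : ∀ {m} (x : Vec (Fin k) m) → project (act (a , b) x) ≡ project x
    project-act-uncut []      = refl
    project-act-uncut (z ∷ r) with letter a b z
    ... | first refl rewrite act-first z b r | side-a | side-b =
      cong₂ _∷_ (cong gate (lastSide-act-uncut r)) (project-act-uncut r)
    ... | second z≢a refl rewrite act-second a z r z≢a | side-a | side-b = refl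
    ... | other z≢a z≢b rewrite act-other a b r z≢a z≢b = refl

  lastSide-act-e : ∀ {m} σ (x : Vec (Fin k) m) → lastSide σ (act (s , t) x) ≡ lastSide σ x
  lastSide-act-e σ []      = refl
  lastSide-act-e σ (z ∷ r) with letter s t z
  ... | first refl rewrite act-first s t r | onEdge-s | onEdge-t = lastSide-act-e σ r
  ... | second z≢s refl rewrite act-second s t r z≢s | onEdge-s | onEdge-t = refl
  ... | other z≢s z≢t rewrite act-other s t r z≢s z≢t = refl

  project-act-e : ∀ {m} (x : Vec (Fin k) m) → binary x ≡ false → project (act (s , t) x) ≡ project x
  project-act-e (z ∷ r) h with letter s t z
  ... | first refl rewrite act-first s t r | side-s | side-t =
    let r-nonbinary = trans (sym (binary-∷ s r onEdge-s)) h
    in  cong₂ _∷_ (cong gate (trans (lastSide-act-e false r) (lastSide-nonbinary false true r r-nonbinary)))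
                  (project-act-e r r-nonbinary)
  ... | second z≢s refl rewrite act-second s t r z≢s | side-s | side-t =
    cong (_∷ project r) (cong gate (lastSide-nonbinary true false r (trans (sym (binary-∷ t r onEdge-t)) h)))
  ... | other z≢s z≢t rewrite act-other s t r z≢s z≢t = refl

  project-act : ∀ {f} → f ∈ E → ∀ {m} (x : Vec (Fin k) m) →
                project (act f x) ≡ project x ⊎ (f ≡ (s , t) × binary x ≡ true)
  project-act {a , b} f∈ x with only-e-cuts f∈
  ... | inj₂ same = inj₁ (project-act-uncut same refl x)
  ... | inj₁ refl with binary x in bin
  ...   | true  = inj₂ (refl , refl)
  ...   | false = inj₁ (project-act-e x bin)

-- Binary words as an odometer

module Odometer {k} {E : List (Fin k × Fin k)} {s t : Fin k} (cut : Cut E s t) where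
  open Cut cut
  open Projection cut

  bit : Fin k → ℕ
  bit a = if a == s then 1 else 0

  bit-s : bit s ≡ 1
  bit-s rewrite ==-refl s = refl

  bit-t : bit t ≡ 0
  bit-t rewrite ==-≢ (s≢t ∘ sym) = refl

  -- On binary words act (s , t) adds one in base two, reading s as 1, t as 0
  -- and the first letter as the least significant digit.  pos is the value of
  -- all digits but the last one, half is the last one.
  pos : ∀ {m} → Vec (Fin k) (suc m) → ℕ
  pos {zero}  (a ∷ []) = 0
  pos {suc m} (a ∷ r)  = bit a + 2 * pos r

  half : ∀ {m} → Vec (Fin k) (suc m) → Bool
  half c = final c == s

  pos<2^ : ∀ {m} (c : Vec (Fin k) (suc m)) → binary c ≡ true → pos c < 2 ^ m
  pos<2^ {zero}  (a ∷ [])  _ = s≤s z≤n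
  pos<2^ {suc m} (a ∷ r)   h = begin
    suc (bit a + 2 * pos r)   ≤⟨ s≤s (+-monoˡ-≤ (2 * pos r) (bit≤1 a)) ⟩
    2 + 2 * pos r             ≡⟨ *-suc 2 (pos r) ⟨
    2 * suc (pos r)           ≤⟨ *-monoʳ-≤ 2 (pos<2^ r (binary-tail a r h)) ⟩
    2 * 2 ^ m                 ∎
    where
    open ≤-Reasoning
    bit≤1 : ∀ a → bit a ≤ 1
    bit≤1 a with a == s
    ... | true  = ≤-refl
    ... | false = z≤n

  odometer : ∀ {m} (c : Vec (Fin k) (suc m)) → binary c ≡ true →
             (pos (act (s , t) c) ≡ suc (pos c) × half (act (s , t) c) ≡ half c) ⊎
             (suc (pos c) ≡ 2 ^ m × pos (act (s , t) c) ≡ 0 × half (act (s , t) c) ≡ not (half c))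
  odometer {zero} (a ∷ []) h with binary-head⁻ a [] h
  ... | inj₁ refl rewrite act-first s t [] | ==-refl s | ==-≢ (s≢t ∘ sym) = inj₂ (refl , refl , refl)
  ... | inj₂ refl rewrite act-second s t [] (s≢t ∘ sym) | ==-refl s | ==-≢ (s≢t ∘ sym) = inj₂ (refl , refl , refl)
  odometer {suc m} (a ∷ r) h with binary-head⁻ a r h
  ... | inj₂ refl rewrite act-second s t r (s≢t ∘ sym) | bit-s | bit-t = inj₁ (refl , refl)
  ... | inj₁ refl rewrite act-first s t r | bit-s | bit-t with odometer r (binary-tail s r h)
  ...   | inj₁ (carry-free , same) rewrite carry-free = inj₁ (*-suc 2 (pos r) , same)
  ...   | inj₂ (wrap , zero-pos , flip) rewrite zero-pos =
    inj₂ (trans (sym (*-suc 2 (pos r))) (cong (2 *_) wrap) , refl , flip)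

  coords-injective : ∀ {m} (c c′ : Vec (Fin k) (suc m)) → binary c ≡ true → binary c′ ≡ true →
                     pos c ≡ pos c′ → half c ≡ half c′ → c ≡ c′
  coords-injective {zero} (a ∷ []) (a′ ∷ []) h h′ _ same-half
    with binary-head⁻ a [] h | binary-head⁻ a′ [] h′
  ... | inj₁ refl | inj₁ refl = refl
  ... | inj₂ refl | inj₂ refl = refl
  ... | inj₁ refl | inj₂ refl rewrite ==-refl s | ==-≢ (s≢t ∘ sym) = contradiction same-half λ ()
  ... | inj₂ refl | inj₁ refl rewrite ==-refl s | ==-≢ (s≢t ∘ sym) = contradiction same-half λ ()
  coords-injective {suc m} (a ∷ r) (a′ ∷ r′) h h′ same-pos same-half
    with binary-head⁻ a r h | binary-head⁻ a′ r′ h′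
  ... | inj₁ refl | inj₁ refl rewrite bit-s = cong (s ∷_) (tails (suc-injective same-pos))
    where tails = λ eq → coords-injective r r′ (binary-tail s r h) (binary-tail s r′ h′) (*-cancelˡ-≡ _ _ 2 eq) same-half
  ... | inj₂ refl | inj₂ refl rewrite bit-t = cong (t ∷_) (tails same-pos)
    where tails = λ eq → coords-injective r r′ (binary-tail t r h) (binary-tail t r′ h′) (*-cancelˡ-≡ _ _ 2 eq) same-half
  ... | inj₁ refl | inj₂ refl rewrite bit-s | bit-t = contradiction (sym same-pos) (even≢odd (pos r′) (pos r))
  ... | inj₂ refl | inj₁ refl rewrite bit-s | bit-t = contradiction same-pos (even≢odd (pos r) (pos r′))

  pos-powLast-s : ∀ m b → suc (pos (powLast (suc m) s b)) ≡ 2 ^ m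
  pos-powLast-s zero    b = refl
  pos-powLast-s (suc m) b rewrite bit-s = trans (sym (*-suc 2 _)) (cong (2 *_) (pos-powLast-s m b))

  pos-powLast-t : ∀ m b → pos (powLast (suc m) t b) ≡ 0
  pos-powLast-t zero    b = refl
  pos-powLast-t (suc m) b rewrite bit-t | pos-powLast-t m b = refl

  gate==s : ∀ σ → (gate σ == s) ≡ σ
  gate==s true  = ==-refl s
  gate==s false = ==-≢ (s≢t ∘ sym)

  half-powLast : ∀ m a σ → half (powLast (suc m) a (gate σ)) ≡ σ
  half-powLast zero    a σ = gate==s σ
  half-powLast (suc m) a σ = half-powLast m a σ

  half-replicate : ∀ m σ → half (replicate (suc m) (gate σ)) ≡ σ
  half-replicate zero    σ = gate==s σ
  half-replicate (suc m) σ = half-replicate m σ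

  half-project : ∀ {m} (x : Vec (Fin k) (suc m)) → half (project x) ≡ side (final x)
  half-project {zero}  (a ∷ []) = gate==s (side a)
  half-project {suc m} (a ∷ r)  = half-project r

module _ {k : ℕ} where

  ∈-allWords : ∀ {m} (y : Vec (Fin k) m) → y ∈ allWords k m
  ∈-allWords []      = here refl
  ∈-allWords (a ∷ y) =
    concatMap⁺ (λ z → map (z ∷_) (allWords k _)) (lose (∈-allFin a) (∈-map⁺ (a ∷_) (∈-allWords y)))

  count-allFin-true : ∀ n → count (λ _ → true) (allFin n) ≡ n
  count-allFin-true n = trans (count-const true (allFin n)) (length-tabulate {n = n} id)

  count-by-head : ∀ {m} (p : Vec (Fin k) (suc m) → Bool) (g : Fin k → Bool) c →
                  (∀ z → count (p ∘ (z ∷_)) (allWords k m) ≡ (if g z then c else 0)) →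
                  count p (allWords k (suc m)) ≡ count g (allFin k) * c
  count-by-head {m} p g c per-head = go (allFin k)
    where
    go : ∀ heads → count p (concatMap (λ z → map (z ∷_) (allWords k m)) heads) ≡ count g heads * c
    go []          = refl
    go (z ∷ heads) rewrite count-++ p (map (z ∷_) (allWords k m)) (concatMap (λ z → map (z ∷_) (allWords k m)) heads)
                         | count-map p (z ∷_) (allWords k m) | per-head z | go heads with g z
    ... | true  = refl
    ... | false = refl

  length-allWords : ∀ m → length (allWords k m) ≡ k ^ m
  length-allWords zero    = refl
  length-allWords (suc m) = begin
    length (allWords k (suc m))              ≡⟨ count-const true (allWords k (suc m)) ⟨
    count (λ _ → true) (allWords k (suc m))  ≡⟨ count-by-head _ (λ _ → true) (k ^ m) (λ _ → per-head) ⟩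
    count (λ _ → true) (allFin k) * k ^ m    ≡⟨ cong (_* k ^ m) (count-allFin-true k) ⟩
    k * k ^ m                                ∎
    where
    open ≡-Reasoning
    per-head = trans (count-const true (allWords k m)) (length-allWords m)

  ⌊∷≟∷⌋ : ∀ {m} a b (x y : Vec (Fin k) m) →
          ⌊ VP.≡-dec F._≟_ (a ∷ x) (b ∷ y) ⌋ ≡ (a == b) ∧ ⌊ VP.≡-dec F._≟_ x y ⌋
  ⌊∷≟∷⌋ a b x y with VP.≡-dec F._≟_ (a ∷ x) (b ∷ y) | a F.≟ b | VP.≡-dec F._≟_ x y
  ... | yes _  | yes _   | yes _   = refl
  ... | no _   | no _    | _       = refl
  ... | no _   | yes _   | no _    = refl
  ... | no ne  | yes a≡b | yes x≡y = contradiction (cong₂ _∷_ a≡b x≡y) ne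
  ... | yes eq | no a≢b  | _       = contradiction (VP.∷-injectiveˡ eq) a≢b
  ... | yes eq | yes _   | no x≢y  = contradiction (VP.∷-injectiveʳ eq) x≢y

  count-allWords-≡ : ∀ {m} (v : Vec (Fin k) m) → count (λ y → ⌊ VP.≡-dec F._≟_ y v ⌋) (allWords k m) ≡ 1
  count-allWords-≡ []      = refl
  count-allWords-≡ {suc m} (b ∷ v) =
    trans (count-by-head _ (_== b) 1 per-head) (trans (*-identityʳ _) (count-allFin-≡ b))
    where
    per-head : ∀ z → count (λ y → ⌊ VP.≡-dec F._≟_ (z ∷ y) (b ∷ v) ⌋) (allWords k m) ≡ (if z == b then 1 else 0)
    per-head z rewrite count-cong (λ y → ⌊∷≟∷⌋ z b y v) (allWords k m) with z == b
    ... | true  = count-allWords-≡ v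
    ... | false = count-const false (allWords k m)

  count-suffix-final : ∀ {n} i′ (p : suc i′ ≤ n) (w : Vec (Fin k) (n ∸ suc i′)) (g : Fin k → Bool) →
                       count (λ y → ⌊ VP.≡-dec F._≟_ (dropN (suc i′) y) w ⌋ ∧ g (final (takeN (suc i′) p y)))
                             (allWords k n)
                       ≡ count g (allFin k) * k ^ i′
  count-suffix-final {suc n} zero (s≤s p) w g = count-by-head _ g 1 per-head
    where
    per-head : ∀ z → count (λ y → ⌊ VP.≡-dec F._≟_ y w ⌋ ∧ g z) (allWords k n) ≡ (if g z then 1 else 0)
    per-head z with g z
    ... | true  = trans (count-cong (λ y → ∧-identityʳ _) (allWords k n)) (count-allWords-≡ w)
    ... | false = trans (count-cong (λ y → ∧-zeroʳ _) (allWords k n)) (count-const false (allWords k n))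
  count-suffix-final {suc n} (suc i′) (s≤s p) w g = begin
    count _ (allWords k (suc n))                  ≡⟨ count-by-head _ (λ _ → true) (c * k ^ i′) (λ _ → previous) ⟩
    count (λ _ → true) (allFin k) * (c * k ^ i′)  ≡⟨ cong (_* (c * k ^ i′)) (count-allFin-true k) ⟩
    k * (c * k ^ i′)                              ≡⟨ *-assoc k c (k ^ i′) ⟨
    k * c * k ^ i′                                ≡⟨ cong (_* k ^ i′) (*-comm k c) ⟩
    c * k * k ^ i′                                ≡⟨ *-assoc c k (k ^ i′) ⟩
    c * k ^ suc i′                                ∎
    where
    open ≡-Reasoning
    c = count g (allFin k)
    previous = count-suffix-final i′ p w g

  count-cycleWords : ∀ (s t : Fin k) {m} M → m ≡ suc M → (g : Fin k → Bool) →
                     count (g ∘ headOr s) (cycleWords k s t m)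
                     ≡ count (λ z → not ((z == s) ∨ (z == t)) ∧ g z) (allFin k) * k ^ M
  count-cycleWords s t M refl g =
    trans (count-filterᵇ (g ∘ headOr s) (headOK s t) (allWords k (suc M))) (count-by-head _ _ (k ^ M) per-head)
    where
    per-head : ∀ z → let b = not ((z == s) ∨ (z == t)) ∧ g z in
               count (λ _ → b) (allWords k M) ≡ (if b then k ^ M else 0)
    per-head z with not ((z == s) ∨ (z == t)) ∧ g z
    ... | true  = trans (count-const true (allWords k M)) (length-allWords M)
    ... | false = count-const false (allWords k M)

-- One e-cycle of length 2 ^ i

module Cycle {k} {E : List (Fin k × Fin k)} {s t : Fin k} (cut : Cut E s t) (e∈ : (s , t) ∈ E)
             {n i′ : ℕ} (p : suc i′ ≤ n) (w : Vec (Fin k) (n ∸ suc i′)) (w-ok : headOK s t w ≡ true) where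
  open Cut cut
  open Projection cut
  open Odometer cut
  open Schreier E n

  private
    Word = Vec (Fin k)
    e = (s , t)
    i = suc i′

  vertex : Word i → Word n
  vertex c = glue p c w

  σw : Bool
  σw = side (headOr s w)

  private
    head-off-edge : onEdge (headOr s w) ≡ false
    head-off-edge = go w w-ok
      where
      go : ∀ {m} (v : Word m) → headOK s t v ≡ true → onEdge (headOr s v) ≡ false
      go (z ∷ _) h = not≡true h

    head≢s : headOr s w ≢ s
    head≢s eq = contradiction (trans (sym head-off-edge) (trans (cong onEdge eq) onEdge-s)) λ ()

    head≢t : headOr s w ≢ t
    head≢t eq = contradiction (trans (sym head-off-edge) (trans (cong onEdge eq) onEdge-t)) λ ()

  act-e-w : act e w ≡ w
  act-e-w = go w head≢s head≢t
    where
    go : ∀ {m} (v : Word m) → headOr s v ≢ s → headOr s v ≢ t → act e v ≡ v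
    go []      _   _   = refl
    go (z ∷ v) z≢s z≢t = act-other s t v z≢s z≢t

  edge-at-head : ∀ {a b v} → (a , b) ∈ E → v ≡ w → headOr s v ≡ a ⊎ headOr s v ≡ b →
                 side a ≡ σw × side b ≡ σw
  edge-at-head f∈ refl at with only-e-cuts f∈ | at
  ... | inj₁ refl | inj₁ h≡s = contradiction h≡s head≢s
  ... | inj₁ refl | inj₂ h≡t = contradiction h≡t head≢t
  ... | inj₂ same | inj₁ refl = refl , sym same
  ... | inj₂ same | inj₂ refl = same , refl

  onW : Word n → Bool
  onW y = ⌊ VP.≡-dec F._≟_ (dropN i y) w ⌋

  -- the cycle vertex from which y hangs
  ρ : Word n → Word i
  ρ y = if onW y then project (takeN i p y) else replicate i (gate σw)

  data ρ-View (y : Word n) : Set where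
    on  : dropN i y ≡ w → ρ y ≡ project (takeN i p y) → ρ-View y
    off : dropN i y ≢ w → ρ y ≡ replicate i (gate σw) → ρ-View y

  ρ-view : ∀ y → ρ-View y
  ρ-view y with VP.≡-dec F._≟_ (dropN i y) w in dec
  ... | yes d = on d (cong choose dec)
    where choose = λ d? → if ⌊ d? ⌋ then project (takeN i p y) else replicate i (gate σw)
  ... | no d  = off d (cong choose dec)
    where choose = λ d? → if ⌊ d? ⌋ then project (takeN i p y) else replicate i (gate σw)

  ρ-on : ∀ {y} → dropN i y ≡ w → ρ y ≡ project (takeN i p y)
  ρ-on {y} d with ρ-view y
  ... | on _ eq  = eq
  ... | off d′ _ = contradiction d d′

  ρ-off : ∀ {y} → dropN i y ≢ w → ρ y ≡ replicate i (gate σw)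
  ρ-off {y} d with ρ-view y
  ... | on d′ _ = contradiction d′ d
  ... | off _ eq = eq

  ρ-binary : ∀ y → binary (ρ y) ≡ true
  ρ-binary y with ρ-view y
  ... | on _ eq  rewrite eq = binary-project (takeN i p y)
  ... | off _ eq rewrite eq = binary-replicate i (onEdge-gate σw)

  ρ-vertex : ∀ {c : Word i} → binary c ≡ true → ρ (vertex c) ≡ c
  ρ-vertex {c} h =
    trans (ρ-on (drop-glue i p c w)) (trans (cong project (take-glue i p c w)) (project-binary c h))

  vertex-ρ : ∀ {y} → dropN i y ≡ w → binary (takeN i p y) ≡ true → y ≡ vertex (ρ y)
  vertex-ρ {y} d h =
    trans (sym (glue-take-drop i p y)) (cong₂ (glue p) (sym (trans (ρ-on d) (project-binary _ h))) d)

  vertex-act : ∀ c → act e (vertex c) ≡ vertex (act e c)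
  vertex-act c = trans (sym (glue-take-drop i p (act e (vertex c)))) (cong₂ (glue p) prefix suffix)
    where
    prefix : takeN i p (act e (vertex c)) ≡ act e c
    prefix = trans (take-act i p e (vertex c)) (cong (act e) (take-glue i p c w))
    suffix : dropN i (act e (vertex c)) ≡ w
    suffix with drop-act i p e (vertex c)
    ... | inj₁ same     = trans same (drop-glue i p c w)
    ... | inj₂ (_ , eq) = trans eq (trans (cong (act e) (drop-glue i p c w)) act-e-w)

  CycleStep : Word n → Word n → Set
  CycleStep y y′ = y ≡ vertex (ρ y) × y′ ≡ vertex (ρ y′) × ρ y′ ≡ act e (ρ y) × binary (ρ y) ≡ true

  private
    act-keeping-suffix : ∀ {f} → f ∈ E → ∀ y → dropN i (act f y) ≡ dropN i y →
                         ρ (act f y) ≡ ρ y ⊎ CycleStep y (act f y)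
    act-keeping-suffix {f} f∈ y same with ρ-view y
    ... | off d eq = inj₁ (trans (ρ-off (d ∘ trans (sym same))) (sym eq))
    ... | on d eq with project-act f∈ (takeN i p y)
    ...   | inj₁ unmoved = inj₁ (begin
      ρ (act f y)                    ≡⟨ ρ-on (trans same d) ⟩
      project (takeN i p (act f y))  ≡⟨ cong project (take-act i p f y) ⟩
      project (act f (takeN i p y))  ≡⟨ unmoved ⟩
      project (takeN i p y)          ≡⟨ eq ⟨
      ρ y                            ∎)
      where open ≡-Reasoning
    ...   | inj₂ (refl , bin) = inj₂ (vertex-ρ d bin , vertex-ρ (trans same d) bin′ ,
                                     trans ρ′ (cong (act e) (sym ρ-y)) , trans (cong binary ρ-y) bin)
      where
      bin′ : binary (takeN i p (act e y)) ≡ true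
      bin′ = trans (cong binary (take-act i p e y)) (binary-act (takeN i p y) bin)
      ρ-y : ρ y ≡ takeN i p y
      ρ-y = trans eq (project-binary _ bin)
      ρ′ : ρ (act e y) ≡ act e (takeN i p y)
      ρ′ = trans (ρ-on (trans same d)) (trans (project-binary _ bin′) (take-act i p e y))

  act-classes : ∀ {f} → f ∈ E → ∀ y → ρ (act f y) ≡ ρ y ⊎ CycleStep y (act f y)
  act-classes {a , b} f∈ y with drop-act i p (a , b) y
  ... | inj₁ same = act-keeping-suffix f∈ y same
  ... | inj₂ (prefix , suffix) with VP.≡-dec F._≟_ (act (a , b) (dropN i y)) (dropN i y)
  ...   | yes unmoved = act-keeping-suffix f∈ y (trans suffix unmoved)
  ...   | no moved with act-moves-head a b s (dropN i y) moved | ρ-view y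
  ...     | before , _ | on d eq = inj₁ (begin
    ρ (act (a , b) y)                ≡⟨ ρ-off (λ d′ → moved (trans (sym suffix) (trans d′ (sym d)))) ⟩
    replicate i (gate σw)            ≡⟨ cong (replicate i ∘ gate) (proj₁ (edge-at-head f∈ d before)) ⟨
    replicate i (gate (side a))      ≡⟨ project-replicate a i ⟨
    project (replicate i a)          ≡⟨ cong project prefix ⟨
    project (takeN i p y)            ≡⟨ eq ⟨
    ρ y                              ∎)
    where open ≡-Reasoning
  ...     | _ , after | off d eq with VP.≡-dec F._≟_ (act (a , b) (dropN i y)) w
  ...       | no d′  = inj₁ (trans (ρ-off (d′ ∘ trans (sym suffix))) (sym eq))
  ...       | yes d′ = inj₁ (begin
    ρ (act (a , b) y)                       ≡⟨ ρ-on (trans suffix d′) ⟩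
    project (takeN i p (act (a , b) y))     ≡⟨ cong project (take-act i p (a , b) y) ⟩
    project (act (a , b) (takeN i p y))     ≡⟨ cong (project ∘ act (a , b)) prefix ⟩
    project (act (a , b) (replicate i a))   ≡⟨ cong project (act-replicate a b i) ⟩
    project (replicate i b)                 ≡⟨ project-replicate b i ⟩
    replicate i (gate (side b))             ≡⟨ cong (replicate i ∘ gate) (proj₂ (edge-at-head f∈ d′ after)) ⟩
    replicate i (gate σw)                   ≡⟨ eq ⟨
    ρ y                                     ∎)
    where open ≡-Reasoning

  H′ : ℕ
  H′ = pred (2 ^ i′)

  suc-H′ : suc H′ ≡ 2 ^ i′
  suc-H′ = suc-pred (2 ^ i′) ⦃ m^n≢0 2 i′ ⦄

  pos≤H′ : ∀ {c : Word i} → binary c ≡ true → pos c ≤ H′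
  pos≤H′ {c} h = <⇒≤pred (pos<2^ c h)

  top bottom : Bool → Word i
  top    σ = powLast i s (gate σ)
  bottom σ = powLast i t (gate σ)

  binary-top : ∀ σ → binary (top σ) ≡ true
  binary-top σ = binary-powLast i onEdge-s (onEdge-gate σ)

  binary-bottom : ∀ σ → binary (bottom σ) ≡ true
  binary-bottom σ = binary-powLast i onEdge-t (onEdge-gate σ)

  pos-top : ∀ σ → pos (top σ) ≡ H′
  pos-top σ = suc-injective (trans (pos-powLast-s i′ (gate σ)) (sym suc-H′))

  pos-bottom : ∀ σ → pos (bottom σ) ≡ 0
  pos-bottom σ = pos-powLast-t i′ (gate σ)

  step-e : ∀ c → Reach 1 (vertex c) (vertex (act e c))
  step-e c = subst (Reach 1 (vertex c)) (vertex-act c) (step-act e∈ (vertex c))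

  climb : ∀ l c → binary c ≡ true → pos c + l ≤ H′ →
          ∃ λ c′ → binary c′ ≡ true × pos c′ ≡ pos c + l × half c′ ≡ half c × Reach l (vertex c) (vertex c′)
  climb zero    c bin _ = c , bin , sym (+-identityʳ _) , refl , reach-refl _
  climb (suc l) c bin ≤H′ with odometer c bin
  ... | inj₂ (wrap , _) = contradiction ≤H′ (<⇒≱ (begin-strict
    H′                 <⟨ n<1+n H′ ⟩
    suc H′             ≡⟨ trans suc-H′ (sym wrap) ⟩
    suc (pos c)        ≤⟨ s≤s (m≤m+n (pos c) l) ⟩
    suc (pos c + l)    ≡⟨ +-suc (pos c) l ⟨
    pos c + suc l      ∎))
    where open ≤-Reasoning
  ... | inj₁ (up , same)
    with climb l (act e c) (binary-act c bin) (subst (_≤ H′) (trans (+-suc (pos c) l) (cong (_+ l) (sym up))) ≤H′)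
  ...   | c′ , bin′ , pos′ , half′ , r =
    c′ , bin′ , trans pos′ (trans (cong (_+ l) up) (sym (+-suc (pos c) l))) , trans half′ same ,
    reach-trans {1} l (step-e c) r

  to-top : ∀ {σ} {c : Word i} → binary c ≡ true → half c ≡ σ → Reach (H′ ∸ pos c) (vertex c) (vertex (top σ))
  to-top {σ} {c} bin h with climb (H′ ∸ pos c) c bin (≤-reflexive (m+[n∸m]≡n (pos≤H′ bin)))
  ... | c′ , bin′ , pos′ , half′ , r = subst (Reach (H′ ∸ pos c) (vertex c) ∘ vertex) c′≡top r
    where
    c′≡top : c′ ≡ top σ
    c′≡top = coords-injective c′ (top σ) bin′ (binary-top σ)
               (trans pos′ (trans (m+[n∸m]≡n (pos≤H′ bin)) (sym (pos-top σ))))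
               (trans half′ (trans h (sym (half-powLast i′ s σ))))

  to-bottom : ∀ {σ} {c : Word i} → binary c ≡ true → half c ≡ σ → Reach (pos c) (vertex c) (vertex (bottom σ))
  to-bottom {σ} {c} bin h
    with climb (pos c) (bottom σ) (binary-bottom σ) (subst (_≤ H′) (cong (_+ pos c) (sym (pos-bottom σ))) (pos≤H′ bin))
  ... | c′ , bin′ , pos′ , half′ , r = reach-sym nbrs-sym (subst (Reach (pos c) (vertex (bottom σ)) ∘ vertex) c′≡c r)
    where
    c′≡c : c′ ≡ c
    c′≡c = coords-injective c′ c bin′ bin (trans pos′ (cong (_+ pos c) (pos-bottom σ)))
                            (trans half′ (trans (half-powLast i′ t σ) (sym h)))

  infix 4 _≈₁_
  _≈₁_ : ℕ → ℕ → Set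
  a ≈₁ b = a ≤ suc b × b ≤ suc a

  module Potential (φ : Bool → ℕ → ℕ) (along : ∀ d q → φ d (suc q) ≈₁ φ d q)
                   (across : ∀ d → φ (not d) 0 ≈₁ φ d H′) (σ : Bool) where

    Φ : Word i → ℕ
    Φ c = φ (half c xor σ) (pos c)

    Φ-act : ∀ c → binary c ≡ true → Φ (act e c) ≈₁ Φ c
    Φ-act c bin with odometer c bin
    ... | inj₁ (up , same) rewrite up | same = along (half c xor σ) (pos c)
    ... | inj₂ (wrap , pos≡0 , flip)
      rewrite pos≡0 | flip | sym (not-distribˡ-xor (half c) σ) | suc-injective (trans wrap (sym suc-H′)) =
      across (half c xor σ)

    edge : ∀ {x z} → x ∈ FinGraph.nbrs Γ z → ρ x ≡ ρ z ⊎ (x ≡ vertex (ρ x) × Φ (ρ z) ≤ suc (Φ (ρ x)))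
    edge {x} {z} x∈ with nbrs⁻ {x} {z} x∈
    ... | f , f∈ , inj₁ refl with act-classes f∈ z
    ...   | inj₁ same                  = inj₁ same
    ...   | inj₂ (_ , x≡ , ρx≡ , bin) =
      inj₂ (x≡ , subst (λ c → Φ (ρ z) ≤ suc (Φ c)) (sym ρx≡) (proj₂ (Φ-act (ρ z) bin)))
    edge {x} {z} x∈ | f , f∈ , inj₂ refl with act-classes f∈ (actInv f z)
    ...   | inj₁ same                  = inj₁ (trans (sym same) (cong ρ (act-actInv f z)))
    ...   | inj₂ (x≡ , _ , ρz≡ , bin) =
      inj₂ (x≡ , subst (λ y → Φ (ρ y) ≤ suc (Φ (ρ x))) (act-actInv f z)
                       (subst (λ c → Φ c ≤ suc (Φ (ρ x))) (sym ρz≡) (proj₁ (Φ-act (ρ x) bin))))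

    open Gates ρ vertex Φ edge public

  private
    if-else-false : ∀ b x → (if b then x else false) ≡ b ∧ x
    if-else-false true  x = refl
    if-else-false false x = refl

    not-if-else-true : ∀ b x → not (if b then x else true) ≡ b ∧ not x
    not-if-else-true true  x = refl
    not-if-else-true false x = refl

    not-xor-self : ∀ σ → not σ xor σ ≡ true
    not-xor-self σ = trans (sym (not-distribˡ-xor σ σ)) (cong not (xor-same σ))

    ∸-suc : ∀ a q → a ∸ suc q ≈₁ a ∸ q
    ∸-suc zero    q       rewrite 0∸n≡0 q = z≤n , z≤n
    ∸-suc (suc a) zero    = ≤-trans (n≤1+n a) (n≤1+n (suc a)) , ≤-refl
    ∸-suc (suc a) (suc q) = ∸-suc a q

    -- With these, Φ σ c is the distance along the cycle from c to bottom σ,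
    -- resp. to top σ.
    φ↑ φ↓ : Bool → ℕ → ℕ
    φ↑ d q = if d then suc H′ ∸ q else q
    φ↓ d q = if d then suc q else H′ ∸ q

    along↑ : ∀ d q → φ↑ d (suc q) ≈₁ φ↑ d q
    along↑ true  q = ∸-suc (suc H′) q
    along↑ false q = ≤-refl , ≤-trans (n≤1+n q) (n≤1+n (suc q))

    across↑ : ∀ d → φ↑ (not d) 0 ≈₁ φ↑ d H′
    across↑ true  = z≤n , ≤-reflexive (m+n∸n≡m 1 H′)
    across↑ false = ≤-refl , ≤-trans (n≤1+n H′) (n≤1+n (suc H′))

    along↓ : ∀ d q → φ↓ d (suc q) ≈₁ φ↓ d q
    along↓ true  q = ≤-refl , ≤-trans (n≤1+n (suc q)) (n≤1+n (suc (suc q)))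
    along↓ false q = ∸-suc H′ q

    across↓ : ∀ d → φ↓ (not d) 0 ≈₁ φ↓ d H′
    across↓ true  = ≤-trans (n≤1+n H′) (n≤1+n (suc H′)) , ≤-refl
    across↓ false rewrite n∸n≡0 H′ = ≤-refl , z≤n

    own-half : ∀ {σ} {c : Word i} → half c ≡ σ → half c xor σ ≡ false
    own-half {σ} hc = trans (cong (_xor σ) hc) (xor-same σ)

    Half : Bool → Word i → Set
    Half σ c = binary c ≡ true × half c ≡ σ

    ¬Half-vertex : ∀ σ {c} → binary c ≡ true → half c ≡ not σ → ¬ Half σ (ρ (vertex c))
    ¬Half-vertex σ bin h (_ , h′) = not-¬ refl (trans (sym (trans (cong half (sym (ρ-vertex bin))) h′)) h)

  closer-to-top : ∀ σ y → half (ρ y) ≡ σ → StrictlyCloser y (vertex (top σ)) (vertex (bottom (not σ)))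
  closer-to-top σ y h =
    closer-than-target (Half σ) (¬Half-vertex σ bin-target (half-powLast i′ t (not σ))) shortcut y (ρ-binary y , h)
    where
    open Potential φ↑ along↑ across↑ σ
    bin-target = binary-bottom (not σ)
    Φ-target : Φ (ρ (vertex (bottom (not σ)))) ≡ suc H′
    Φ-target = begin
      Φ (ρ (vertex (bottom (not σ))))  ≡⟨ cong Φ (ρ-vertex bin-target) ⟩
      Φ (bottom (not σ))               ≡⟨ cong₂ (λ h → φ↑ (h xor σ)) (half-powLast i′ t (not σ)) (pos-bottom (not σ)) ⟩
      φ↑ (not σ xor σ) 0               ≡⟨ cong (λ d → φ↑ d 0) (not-xor-self σ) ⟩
      suc H′                           ∎
      where open ≡-Reasoning
    shortcut : ∀ c → Half σ c →
               ∃ λ l → Reach l (vertex c) (vertex (top σ)) × l + suc (Φ c) ≤ Φ (ρ (vertex (bottom (not σ))))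
    shortcut c (bin , hc) = H′ ∸ pos c , to-top bin hc , ≤-reflexive (begin
      H′ ∸ pos c + suc (Φ c)        ≡⟨ cong (λ d → H′ ∸ pos c + suc (φ↑ d (pos c))) (own-half hc) ⟩
      H′ ∸ pos c + suc (pos c)      ≡⟨ +-suc (H′ ∸ pos c) (pos c) ⟩
      suc (H′ ∸ pos c + pos c)      ≡⟨ cong suc (m∸n+n≡m (pos≤H′ bin)) ⟩
      suc H′                        ≡⟨ Φ-target ⟨
      Φ (ρ (vertex (bottom (not σ)))) ∎)
      where open ≡-Reasoning

  closer-to-bottom : ∀ σ y → half (ρ y) ≡ σ → StrictlyCloser y (vertex (bottom σ)) (vertex (top (not σ)))
  closer-to-bottom σ y h =
    closer-than-target (Half σ) (¬Half-vertex σ bin-target (half-powLast i′ s (not σ))) shortcut y (ρ-binary y , h)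
    where
    open Potential φ↓ along↓ across↓ σ
    bin-target = binary-top (not σ)
    Φ-target : Φ (ρ (vertex (top (not σ)))) ≡ suc H′
    Φ-target = begin
      Φ (ρ (vertex (top (not σ))))     ≡⟨ cong Φ (ρ-vertex bin-target) ⟩
      Φ (top (not σ))                  ≡⟨ cong₂ (λ h → φ↓ (h xor σ)) (half-powLast i′ s (not σ)) (pos-top (not σ)) ⟩
      φ↓ (not σ xor σ) H′              ≡⟨ cong (λ d → φ↓ d H′) (not-xor-self σ) ⟩
      suc H′                           ∎
      where open ≡-Reasoning
    shortcut : ∀ c → Half σ c →
               ∃ λ l → Reach l (vertex c) (vertex (bottom σ)) × l + suc (Φ c) ≤ Φ (ρ (vertex (top (not σ))))
    shortcut c (bin , hc) = pos c , to-bottom bin hc , ≤-reflexive (begin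
      pos c + suc (Φ c)             ≡⟨ cong (λ d → pos c + suc (φ↓ d (pos c))) (own-half hc) ⟩
      pos c + suc (H′ ∸ pos c)      ≡⟨ +-suc (pos c) (H′ ∸ pos c) ⟩
      suc (pos c + (H′ ∸ pos c))    ≡⟨ cong suc (m+[n∸m]≡n (pos≤H′ bin)) ⟩
      suc H′                        ≡⟨ Φ-target ⟨
      Φ (ρ (vertex (top (not σ))))  ∎)
      where open ≡-Reasoning

  module SpecialEdges (connected : Connected (treeGraph k E)) where
    open Exhaustive ∈-allWords
    open SchreierConnected E connected using (schreier-connected)

    private
      words = allWords k n
      A = count (half ∘ ρ) words
      B = count (not ∘ half ∘ ρ) words

      powLast-replicate : ∀ m (a : Fin k) → powLast (suc m) a a ≡ replicate (suc m) a
      powLast-replicate zero    a = refl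
      powLast-replicate (suc m) a = cong (a ∷_) (powLast-replicate m a)

      A+B : A + B ≡ k ^ n
      A+B = trans (count-+-count-not (half ∘ ρ) words) (length-allWords n)

    special-edgeProds : edgeProd Γ (special₁ p s t w) ≡ A * B × edgeProd Γ (special₂ p s t w) ≡ B * A
    special-edgeProds = edgeProd₁ , cong₂ _*_ (proj₂ nClose₂) (proj₁ nClose₂)
      where
      nClose₁ = nClose≡count (schreier-connected n) (half ∘ ρ) (closer-to-top true) (closer-to-bottom false)
      nClose₂ = nClose≡count (schreier-connected n) (half ∘ ρ) (closer-to-bottom true) (closer-to-top false)
      edgeProd₁ : edgeProd Γ (special₁ p s t w) ≡ A * B
      edgeProd₁ = subst₂ (λ x y → edgeProd Γ (vertex x , vertex y) ≡ A * B)
                         (powLast-replicate i′ s) (powLast-replicate i′ t) (cong₂ _*_ (proj₁ nClose₁) (proj₂ nClose₁))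

    final-side : Word n → Bool
    final-side y = side (final (takeN i p y))

    half-ρ : ∀ y → half (ρ y) ≡ (if onW y then final-side y else σw)
    half-ρ y = trans (if-float half (onW y) {project (takeN i p y)} {replicate i (gate σw)})
                     (cong₂ (if onW y then_else_) (half-project (takeN i p y)) (half-replicate i′ σw))

    edgeProds-hanging-on-t-side : σw ≡ false → ∀ {c} → count side (allFin k) ≡ c → let X = c * k ^ i′ in
                                  edgeProd Γ (special₁ p s t w) ≡ X * (k ^ n ∸ X) ×
                                  edgeProd Γ (special₂ p s t w) ≡ X * (k ^ n ∸ X)
    edgeProds-hanging-on-t-side σw≡false {c} c≡ =
      trans (proj₁ special-edgeProds) (cong₂ _*_ A≡X B≡) ,
      trans (proj₂ special-edgeProds) (trans (cong₂ _*_ B≡ A≡X) (*-comm (k ^ n ∸ X) X))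
      where
      X = c * k ^ i′
      A≡X : A ≡ X
      half-ρ≡ : ∀ y → half (ρ y) ≡ onW y ∧ final-side y
      half-ρ≡ y = trans (half-ρ y) (trans (cong (if onW y then final-side y else_) σw≡false)
                                          (if-else-false (onW y) (final-side y)))
      A≡X = trans (count-cong half-ρ≡ words) (trans (count-suffix-final i′ p w side) (cong (_* k ^ i′) c≡))
      B≡ : B ≡ k ^ n ∸ X
      B≡ = trans (sym (m+n∸m≡n A B)) (cong₂ _∸_ A+B A≡X)

    edgeProds-hanging-on-s-side : σw ≡ true → ∀ {c} → count (not ∘ side) (allFin k) ≡ c → let Y = c * k ^ i′ in
                                  edgeProd Γ (special₁ p s t w) ≡ Y * (k ^ n ∸ Y) ×
                                  edgeProd Γ (special₂ p s t w) ≡ Y * (k ^ n ∸ Y)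
    edgeProds-hanging-on-s-side σw≡true {c} c≡ =
      trans (proj₁ special-edgeProds) (trans (cong₂ _*_ A≡ B≡Y) (*-comm (k ^ n ∸ Y) Y)) ,
      trans (proj₂ special-edgeProds) (cong₂ _*_ B≡Y A≡)
      where
      Y = c * k ^ i′
      B≡Y : B ≡ Y
      not-half-ρ≡ : ∀ y → not (half (ρ y)) ≡ onW y ∧ not (final-side y)
      not-half-ρ≡ y = trans (cong not (trans (half-ρ y) (cong (if onW y then final-side y else_) σw≡true)))
                            (not-if-else-true (onW y) (final-side y))
      B≡Y = trans (count-cong not-half-ρ≡ words) (trans (count-suffix-final i′ p w (not ∘ side)) (cong (_* k ^ i′) c≡))
      A≡ : A ≡ k ^ n ∸ Y
      A≡ = trans (sym (m+n∸n≡m A B)) (cong₂ _∸_ A+B B≡Y)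

module _ {k} {E : List (Fin k × Fin k)} (tree : IsTree k E) {s t} (e∈ : (s , t) ∈ E) where
  private
    cut = TreeCut.cut E tree e∈
    G = treeGraph k E
    open Cut cut
    open Projection cut using (onEdge; onEdge∧side; onEdge∧not-side; count-off-edge)

    nst≡ : nClose G s t ≡ count side (allFin k)
    nst≡ = proj₁ (CutDistances.nClose-cut cut (proj₁ tree))

    nts≡ : nClose G t s ≡ count (not ∘ side) (allFin k)
    nts≡ = proj₂ (CutDistances.nClose-cut cut (proj₁ tree))

    count-cycles : ∀ {n i′} → suc i′ < n → ∀ (g : Fin k → Bool) σ → (∀ z → onEdge z ∧ g z ≡ (z == gate σ)) →
                   count (g ∘ headOr s) (cycleWords k s t (n ∸ suc i′))
                   ≡ (count g (allFin k) ∸ 1) * k ^ (n ∸ 1 ∸ suc i′)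
    count-cycles {n} {i′} i<n g σ on-edge =
      trans (count-cycleWords s t (n ∸ suc (suc i′)) (+-∸-assoc 1 i<n) g)
            (cong₂ _*_ (count-off-edge g σ on-edge) (cong (k ^_) (sym (∸-+-assoc n 1 (suc i′)))))

  count-cycles-on-t-side : ∀ {n i′} → suc i′ < n →
                           count (not ∘ side ∘ headOr s) (cycleWords k s t (n ∸ suc i′))
                           ≡ (nClose G t s ∸ 1) * k ^ (n ∸ 1 ∸ suc i′)
  count-cycles-on-t-side i<n =
    trans (count-cycles i<n (not ∘ side) false onEdge∧not-side) (cong (λ c → (c ∸ 1) * _) (sym nts≡))

  count-cycles-on-s-side : ∀ {n i′} → suc i′ < n →
                           count (side ∘ headOr s) (cycleWords k s t (n ∸ suc i′))
                           ≡ (nClose G s t ∸ 1) * k ^ (n ∸ 1 ∸ suc i′)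
  count-cycles-on-s-side i<n =
    trans (count-cycles i<n side true onEdge∧side) (cong (λ c → (c ∸ 1) * _) (sym nst≡))

  edgeProd-special : ∀ {n i′} (i<n : suc i′ < n) w → w ∈ cycleWords k s t (n ∸ suc i′) →
                     let Γ   = schreier k E n
                         p   = <⇒≤ i<n
                         val = λ c → c * k ^ i′ * (k ^ n ∸ c * k ^ i′) in
                     (side (headOr s w) ≡ false → edgeProd Γ (special₁ p s t w) ≡ val (nClose G s t)
                                                × edgeProd Γ (special₂ p s t w) ≡ val (nClose G s t))
                   × (side (headOr s w) ≡ true  → edgeProd Γ (special₁ p s t w) ≡ val (nClose G t s)
                                                × edgeProd Γ (special₂ p s t w) ≡ val (nClose G t s))
  edgeProd-special {n} {i′} i<n w w∈ =
    (λ on-t → edgeProds-hanging-on-t-side on-t (sym nst≡)) , (λ on-s → edgeProds-hanging-on-s-side on-s (sym nts≡))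
    where
    w-ok : headOK s t w ≡ true
    w-ok = Equivalence.to T-≡ (proj₂ (∈-filter⁻ (T? ∘ headOK s t) {xs = allWords k (n ∸ suc i′)} w∈))
    open Cycle.SpecialEdges cut e∈ (<⇒≤ i<n) w w-ok (proj₁ tree)

mainTheorem10 : (k : ℕ) (E : List (Fin k × Fin k)) → IsTree k E →
    (n : ℕ) → 1 ≤ n → (s t : Fin k) → (s , t) ∈ E →
    (i : ℕ) → 1 ≤ i → (i<n : i < n) →
    let Γ   = schreier k E n
        G   = treeGraph k E
        nst = nClose G s t
        nts = nClose G t s
        cyc = cycleWords k s t (n ∸ i)
        p   = <⇒≤ i<n
        valS = nst * k ^ (i ∸ 1) * (k ^ n ∸ nst * k ^ (i ∸ 1))
        valT = nts * k ^ (i ∸ 1) * (k ^ n ∸ nts * k ^ (i ∸ 1))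
    in Σ (Vec (Fin k) (n ∸ i) → Bool) λ P →
         (count P cyc ≡ (nts ∸ 1) * k ^ (n ∸ 1 ∸ i))
       × (count (λ w → not (P w)) cyc ≡ (nst ∸ 1) * k ^ (n ∸ 1 ∸ i))
       × (∀ w → w ∈ cyc →
            (P w ≡ true → (edgeProd Γ (special₁ p s t w) ≡ valS)
                        × (edgeProd Γ (special₂ p s t w) ≡ valS))
          × (P w ≡ false → (edgeProd Γ (special₁ p s t w) ≡ valT)
                        × (edgeProd Γ (special₂ p s t w) ≡ valT)))
mainTheorem10 k E tree n _ s t e∈ (suc i′) _ i<n =
  P ,
  count-cycles-on-t-side tree e∈ i<n ,
  trans (count-cong (not-involutive ∘ side ∘ headOr s) (cycleWords k s t (n ∸ suc i′))) (count-cycles-on-s-side tree e∈ i<n) ,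
  λ w w∈ → Product.map (_∘ not≡true) (_∘ not≡false) (edgeProd-special tree e∈ i<n w w∈)
  where
  open Cut (TreeCut.cut E tree e∈) using (side)
  P : Vec (Fin k) (n ∸ suc i′) → Bool
  P w = not (side (headOr s w))
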